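{- Assume $\Delta>0$. The following are equivalent: (1) $\mathcal C(\mathbb Z)\simeq\mathbb Z/2\mathbb Z\oplus\mathbb Z$; (2) the image of $\alpha:\mathcal C(\mathbb Z)\to\mathbb Q^\times/\mathbb Q^{\times2}$ has exactly $4$ elements.
   Context: Let $d$ be a squarefree integer with $d\neq 1$, and put $\Delta=d$ if $d\equiv 1\pmod 4$ and $\Delta=4d$ if $d\equiv 2,3\pmod 4$. Let $\mathcal C(\mathbb Z)=\{(x,y)\in\mathbb Z^2: x^2-\Delta y^2=4\}$, an abelian group with neutral element $(2,0)$ and addition $(r,s)+(t,u)=\big(\frac{rt+\Delta su}{2},\frac{ru+st}{2}\big)$. The map $\alpha$ is given by $\alpha(x,y)=(x+2)\mathbb Q^{\times2}$ if $x\neq-2$ and $\alpha(-2,0)=-\Delta\,\mathbb Q^{\times2}$. -}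

module Defs where

open import Data.Bool using (Bool; _xor_)
open import Data.Nat as ℕ using (ℕ)
open import Data.Integer as ℤ using (ℤ; +_; _-_; ∣_∣)
open import Data.Integer.DivMod using (_%ℕ_)
open import Data.Nat.Divisibility using (_∣_)
open import Data.Rational as ℚ using (ℚ)
open import Data.Product using (Σ; ∃; _×_; _,_)
open import Data.Fin using (Fin)
open import Relation.Nullary using (¬_; yes; no)
open import Relation.Binary.PropositionalEquality using (_≡_; _≢_)
open import Function.Bundles using (_↔_; Inverse)

-- d is squarefree: the only natural n with n² ∣ |d| is n = 1 (so d ≠ 0).
SquareFree : ℤ → Set
SquareFree d = ∀ (n : ℕ) → (n ℕ.* n) ∣ ∣ d ∣ → n ≡ 1

Disc : ℤ → ℤ
Disc d with d %ℕ 4 ℕ.≟ 1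
... | yes _ = d
... | no  _ = + 4 ℤ.* d

record Pt (Δ : ℤ) : Set where
  constructor pt
  field
    x : ℤ
    y : ℤ
    .onC : x ℤ.* x - Δ ℤ.* (y ℤ.* y) ≡ + 4
open Pt public

-- R = P + Q in C(ℤ), i.e. R = ((rt + Δsu)/2, (ru + st)/2), written without division.
IsSum : (Δ : ℤ) → Pt Δ → Pt Δ → Pt Δ → Set
IsSum Δ P Q R =
  (+ 2 ℤ.* x R ≡ x P ℤ.* x Q ℤ.+ Δ ℤ.* (y P ℤ.* y Q)) ×
  (+ 2 ℤ.* y R ≡ x P ℤ.* y Q ℤ.+ y P ℤ.* x Q)

-- The group ℤ/2ℤ ⊕ ℤ, with ℤ/2ℤ modelled as Bool under xor.
_⊕_ : Bool × ℤ → Bool × ℤ → Bool × ℤ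
(a , m) ⊕ (b , n) = (a xor b , m ℤ.+ n)

IsoZ2Z : ℤ → Set
IsoZ2Z Δ = Σ (Pt Δ ↔ (Bool × ℤ)) λ f →
  ∀ P Q R → IsSum Δ P Q R → Inverse.to f R ≡ (Inverse.to f P ⊕ Inverse.to f Q)

-- Representative in ℚ^× of α(P) ∈ ℚ^×/ℚ^×²:
-- α(x,y) = x + 2 if x ≠ −2, and α(−2,0) = −Δ.
α : (Δ : ℤ) → Pt Δ → ℚ
α Δ P with x P ℤ.≟ ℤ.- (+ 2)
... | yes _ = (ℤ.- Δ) ℚ./ 1
... | no  _ = (x P ℤ.+ + 2) ℚ./ 1

-- Equality in ℚ^×/ℚ^×²: a and b differ by a nonzero rational square.
SqEq : ℚ → ℚ → Set
SqEq a b = ∃ λ (q : ℚ) → q ≢ ℚ.0ℚ × a ≡ b ℚ.* (q ℚ.* q)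

ImageCard4 : (Δ : ℤ) → Set
ImageCard4 Δ = Σ (Fin 4 → Pt Δ) λ v →
  (∀ i j → i ≢ j → ¬ SqEq (α Δ (v i)) (α Δ (v j))) ×
  (∀ P → ∃ λ i → SqEq (α Δ P) (α Δ (v i)))

{-# OPTIONS --safe #-}

-- For Δ > 0 both conditions are equivalent to C(ℤ) having a point with y ≠ 0.
-- Given one, let ε = (a₁, b₁) be the point with least positive y.  Subtracting ε from a
-- point with x > 0 and y > 0 leaves x > 0 and lowers y ≥ 0, so by descent every point is
-- i·ε or T ⊞ i·ε, where T = (−2, 0); hence C(ℤ) ≅ ℤ/2ℤ ⊕ ℤ.  As the product of the x + 2
-- over P, Q and P ⊞ Q is a square, α takes, up to squares, the values 4, −Δ, a₁ + 2 and
-- 2 − a₁.  Signs separate most of them, and a₁ + 2 is not a square: d being square-free,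
-- ε would otherwise be twice a point of smaller y.  If instead every point has y = 0, then
-- C(ℤ) = {O, T}, which is neither ℤ/2ℤ ⊕ ℤ nor has four α-classes.

module Submission where

open import Defs
open import Algebra.Bundles using (AbelianGroup)
open import Algebra.Structures using (IsAbelianGroup)
open import Data.Bool using (Bool; true; false; _xor_)
open import Data.Empty using (⊥-elim)
open import Data.Fin using (Fin; zero; suc)
open import Data.Fin.Patterns using (0F; 1F; 2F; 3F)
open import Data.Integer as ℤ using (ℤ; +_; -[1+_]; +[1+_])
import Data.Integer.Properties as ℤP
open import Data.Integer.DivMod using (_%ℕ_; _/ℕ_; a≡a%ℕn+[a/ℕn]*n; n%ℕd<d)
open import Data.List using (_∷_; [])
open import Data.Nat as ℕ using (ℕ; zero; suc; z≤n; s≤s; z<s)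
import Data.Nat.Properties as ℕP
open import Data.Nat.Induction using (<-rec)
import Data.Rational as ℚ
import Data.Rational.Properties as ℚP
open import Data.Rational.Unnormalised as ℚᵘ using (mkℚᵘ; *≡*)
import Data.Rational.Unnormalised.Properties as ℚᵘP
open import Data.Product using (∃; ∃₂; _×_; _,_; proj₁; proj₂)
open import Data.Sum using (_⊎_; inj₁; inj₂; [_,_]′)
open import Function using (_∘_)
open import Function.Bundles using (_⇔_; mk⇔; Inverse; mk↔ₛ′)
open import Level using (0ℓ)
open import Relation.Nullary using (¬_; Dec; yes; no; map′; _×-dec_; recompute)
open import Relation.Unary using (Pred; Decidable)
open import Relation.Binary.PropositionalEquality
  using (_≡_; _≢_; refl; sym; trans; cong; cong₂; subst; subst₂; module ≡-Reasoning)
open import Relation.Binary.PropositionalEquality.Algebra using (isMagma)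

module Squares where

  open import Data.Nat
  open import Data.Nat.Properties
  open import Data.Nat.Divisibility
  open import Data.Nat.DivMod using (_/_; m/n*n≡m)
  open import Data.Nat.Coprimality as Coprimality using (Coprime; coprime-divisor; coprime-/gcd)
  open import Data.Nat.GCD using (gcd; gcd[m,n]∣m; gcd[m,n]∣n; gcd[m,n]≢0)
  open import Data.Nat.Primality using (euclidsLemma; prime[2])
  open import Data.Nat.Tactic.RingSolver using (solve)

  m*m<n*n⇒m<n : ∀ {m n} → m * m < n * n → m < n
  m*m<n*n⇒m<n {m} {n} mm<nn with <-≤-connex m n
  ... | inj₁ m<n = m<n
  ... | inj₂ n≤m = ⊥-elim (<-irrefl refl (<-≤-trans mm<nn (*-mono-≤ n≤m n≤m)))

  m*m≤n*n⇒m≤n : ∀ {m n} → m * m ≤ n * n → m ≤ n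
  m*m≤n*n⇒m≤n {m} {n} mm≤nn with ≤-<-connex m n
  ... | inj₁ m≤n = m≤n
  ... | inj₂ n<m = ⊥-elim (<-irrefl refl (<-≤-trans (*-mono-< n<m n<m) mm≤nn))

  m*m≡n*n⇒m≡n : ∀ {m n} → m * m ≡ n * n → m ≡ n
  m*m≡n*n⇒m≡n mm≡nn =
    ≤-antisym (m*m≤n*n⇒m≤n (≤-reflexive mm≡nn)) (m*m≤n*n⇒m≤n (≤-reflexive (sym mm≡nn)))

  n≤n*n : ∀ n → n ≤ n * n
  n≤n*n zero    = z≤n
  n≤n*n (suc n) = m≤m*n (suc n) (suc n)

  IsSquare : ℕ → Set
  IsSquare n = ∃ λ s → s * s ≡ n

  isSquare? : Decidable IsSquare
  isSquare? n = map′ (λ (s , _ , ss≡n) → s , ss≡n)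
                     (λ (s , ss≡n) → s , s≤s (subst (s ≤_) ss≡n (n≤n*n s)) , ss≡n)
                     (anyUpTo? (λ s → s * s ≟ n) (suc n))

  least-witness : ∀ {p} {P : Pred ℕ p} → Decidable P →
                  ∀ {n} → P n → ∃ λ m → P m × (∀ {k} → k < m → ¬ P k)
  least-witness {P = P} P? {n} = <-rec Goal step n
    where
      Goal : ℕ → Set _
      Goal n = P n → ∃ λ m → P m × (∀ {k} → k < m → ¬ P k)
      step : ∀ n → (∀ {k} → k < n → Goal k) → Goal n
      step n below Pn with anyUpTo? P? n
      ... | yes (k , k<n , Pk) = below k<n Pk
      ... | no  none          = n , Pn , λ k<n Pk → none (_ , k<n , Pk)

  coprime-squares : ∀ {m n} → Coprime m n → Coprime (m * m) (n * n)
  coprime-squares m⊥n = Coprimality.sym (coprime-*ʳ (Coprimality.sym (coprime-*ʳ m⊥n)))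
    where
      coprime-*ʳ : ∀ {m n} → Coprime m n → Coprime m (n * n)
      coprime-*ʳ {m} {n} m⊥n {d} (d∣m , d∣nn) = m⊥n (d∣m , coprime-divisor d⊥n d∣nn)
        where
          d⊥n : Coprime d n
          d⊥n (k∣d , k∣n) = m⊥n (∣-trans k∣d d∣m , k∣n)

  squarefree-∣ : ∀ {e a Y} → SquareFree (+ e) → a ≢ 0 → a * a ∣ e * (Y * Y) → a ∣ Y
  squarefree-∣ {e} {a} {Y} sf a≢0 aa∣eYY = subst (_∣ Y) g≡a (gcd[m,n]∣n a Y)
    where
      g = gcd a Y
      instance
        g≢0 : NonZero g
        g≢0 = ≢-nonZero (gcd[m,n]≢0 a Y (inj₁ a≢0))
      cancel-gcd : ∀ a′ Y′ g .{{_ : NonZero g}} →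
                   (a′ * g) * (a′ * g) ∣ e * ((Y′ * g) * (Y′ * g)) → a′ * a′ ∣ Y′ * Y′ * e
      cancel-gcd a′ Y′ g h = *-cancelʳ-∣ (g * g) {{m*n≢0 g g}} (begin
        a′ * a′ * (g * g)             ≡⟨ solve (a′ ∷ g ∷ []) ⟩
        (a′ * g) * (a′ * g)           ∣⟨ h ⟩
        e * ((Y′ * g) * (Y′ * g))     ≡⟨ solve (e ∷ Y′ ∷ g ∷ []) ⟩
        Y′ * Y′ * e * (g * g)         ∎)
        where open ∣-Reasoning
      a/g*g≡a = m/n*n≡m (gcd[m,n]∣m a Y)
      Y/g*g≡Y = m/n*n≡m (gcd[m,n]∣n a Y)
      a/g≡1 : a / g ≡ 1
      a/g≡1 = sf (a / g) (coprime-divisor (coprime-squares (coprime-/gcd a Y)) (cancel-gcd (a / g) (Y / g) g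
                (subst₂ (λ u v → u * u ∣ e * (v * v)) (sym a/g*g≡a) (sym Y/g*g≡Y) aa∣eYY)))
      g≡a : g ≡ a
      g≡a = trans (sym (*-identityˡ g)) (trans (cong (_* g) (sym a/g≡1)) a/g*g≡a)

  squarefree-split : ∀ {e s t Y} → SquareFree (+ e) → s ≢ 0 → s * s * t ≡ e * (Y * Y) →
                     ∃ λ b → Y ≡ s * b × t ≡ e * (b * b)
  squarefree-split {e} {s} {t} {Y} sf s≢0 sst≡eYY = b , trans Y≡bs (*-comm b s) , t≡ebb
    where
      open ≡-Reasoning
      s∣Y : s ∣ Y
      s∣Y = squarefree-∣ sf s≢0 (divides t (trans (sym sst≡eYY) (*-comm (s * s) t)))
      b = quotient s∣Y
      Y≡bs : Y ≡ b * s
      Y≡bs = _∣_.equality s∣Y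
      t≡ebb : t ≡ e * (b * b)
      t≡ebb = *-cancelˡ-≡ t (e * (b * b)) (s * s) {{m*n≢0 s s {{≢-nonZero s≢0}} {{≢-nonZero s≢0}}}}
        (begin
        s * s * t               ≡⟨ sst≡eYY ⟩
        e * (Y * Y)             ≡⟨ cong (λ u → e * (u * u)) Y≡bs ⟩
        e * ((b * s) * (b * s)) ≡⟨ regroup e b s ⟩
        s * s * (e * (b * b))   ∎)
        where regroup : ∀ e b s → e * ((b * s) * (b * s)) ≡ s * s * (e * (b * b))
              regroup e b s = solve (e ∷ b ∷ s ∷ [])

  even-square : ∀ {n k} → n * n ≡ 2 * k → ∃ λ h → n ≡ 2 * h
  even-square {n} {k} nn≡2k with euclidsLemma n n prime[2] (divides k (trans nn≡2k (*-comm 2 k)))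
  ... | inj₁ (divides h n≡h2) = h , trans n≡h2 (*-comm h 2)
  ... | inj₂ (divides h n≡h2) = h , trans n≡h2 (*-comm h 2)

  squarefree-1 : SquareFree (+ 1)
  squarefree-1 n nn∣1 = m*n≡1⇒m≡1 n n (∣1⇒≡1 nn∣1)

  square-ratio : ∀ {k M N} → M ≢ 0 → k * (M * M) ≡ N * N → IsSquare k
  square-ratio {k} {M} {N} M≢0 kMM≡NN = s , *-cancelʳ-≡ (s * s) k (M * M) {{M²≢0}} (begin
    s * s * (M * M)     ≡⟨ regroup s M ⟩
    (s * M) * (s * M)   ≡⟨ cong (λ u → u * u) N≡sM ⟨
    N * N               ≡⟨ kMM≡NN ⟨
    k * (M * M)         ∎)
    where
      open ≡-Reasoning
      M∣N = squarefree-∣ squarefree-1 M≢0 (divides k (trans (+-identityʳ (N * N)) (sym kMM≡NN)))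
      s = quotient M∣N
      N≡sM : N ≡ s * M
      N≡sM = _∣_.equality M∣N
      M²≢0 = m*n≢0 M M {{≢-nonZero M≢0}} {{≢-nonZero M≢0}}
      regroup : ∀ s M → s * s * (M * M) ≡ (s * M) * (s * M)
      regroup s M = solve (s ∷ M ∷ [])

  -- (s, Y / s) is the point whose double is (X, Y): points where x + 2 is a square are halvable.
  Halving : ℕ → Set
  Halving D = ∀ X Y s → X * X ≡ 4 + D * (Y * Y) → X + 2 ≡ s * s →
              ∃ λ b → Y ≡ s * b × s * s ≡ 4 + D * (b * b)

  ≥2-on-curve : ∀ {X k} → X * X ≡ 4 + k → ∃ λ t → X ≡ 2 + t
  ≥2-on-curve {suc (suc t)} _ = t , refl

  private
    square≢0 : ∀ {s n} → s * s ≡ suc n → s ≢ 0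
    square≢0 ss≡1+n refl = 0≢1+n ss≡1+n

  halving-squarefree : ∀ {D} → SquareFree (+ D) → Halving D
  halving-squarefree {D} sf X Y s XX≡ X+2≡ss with ≥2-on-curve {X} XX≡
  ... | t , refl = b , Y≡sb , (begin
      s * s           ≡⟨ X+2≡ss ⟨
      2 + t + 2       ≡⟨ solve (t ∷ []) ⟩
      4 + t           ≡⟨ cong (λ k → 4 + k) t≡Dbb ⟩
      4 + D * (b * b) ∎)
    where
      open ≡-Reasoning
      sst≡DYY : s * s * t ≡ D * (Y * Y)
      sst≡DYY = +-cancelˡ-≡ 4 (s * s * t) (D * (Y * Y)) (begin
        4 + s * s * t          ≡⟨ cong (λ k → 4 + k * t) X+2≡ss ⟨
        4 + (2 + t + 2) * t    ≡⟨ solve (t ∷ []) ⟩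
        (2 + t) * (2 + t)      ≡⟨ XX≡ ⟩
        4 + D * (Y * Y)        ∎)
      split = squarefree-split {D} {s} {t} {Y} sf (square≢0 {s} (trans (sym X+2≡ss) (+-comm (2 + t) 2))) sst≡DYY
      b = proj₁ split
      Y≡sb = proj₁ (proj₂ split)
      t≡Dbb = proj₂ (proj₂ split)

  -- Here X = 2u and s = 2(1 + v); then u = 1 + 2r with r = v² + 2v, and s² r = d Y².
  halving-4* : ∀ {d} → SquareFree (+ d) → Halving (4 * d)
  halving-4* {d} sf X Y s XX≡ X+2≡ss
    with even-square {X} {2 + 2 * d * (Y * Y)} (trans XX≡ (solve (d ∷ Y ∷ [])))
  ... | u , refl with even-square {s} {u + 1} (trans (sym X+2≡ss) (solve (u ∷ [])))
  ... | zero  , refl = ⊥-elim (0≢1+n (sym (trans (+-comm 2 (2 * u)) X+2≡ss)))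
  ... | suc v , refl = b , Y≡sb , (begin
      (2 * (1 + v)) * (2 * (1 + v)) ≡⟨ solve (v ∷ []) ⟩
      4 + 4 * (v * v + 2 * v)       ≡⟨ cong (λ k → 4 + 4 * k) r≡dbb ⟩
      4 + 4 * (d * (b * b))         ≡⟨ cong (λ k → 4 + k) (*-assoc 4 d (b * b)) ⟨
      4 + 4 * d * (b * b)           ∎)
    where
      open ≡-Reasoning
      u≡1+2r : u ≡ 1 + 2 * (v * v + 2 * v)
      u≡1+2r = *-cancelˡ-≡ u (1 + 2 * (v * v + 2 * v)) 2
        (+-cancelʳ-≡ 2 (2 * u) (2 * (1 + 2 * (v * v + 2 * v))) (begin
          2 * u + 2                           ≡⟨ X+2≡ss ⟩
          (2 * (1 + v)) * (2 * (1 + v))       ≡⟨ solve (v ∷ []) ⟩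
          2 * (1 + 2 * (v * v + 2 * v)) + 2   ∎))
      ssr≡dYY : (2 * (1 + v)) * (2 * (1 + v)) * (v * v + 2 * v) ≡ d * (Y * Y)
      ssr≡dYY = *-cancelˡ-≡ ((2 * (1 + v)) * (2 * (1 + v)) * (v * v + 2 * v)) (d * (Y * Y)) 4
                  (+-cancelˡ-≡ 4 (4 * ((2 * (1 + v)) * (2 * (1 + v)) * (v * v + 2 * v))) (4 * (d * (Y * Y))) (begin
        4 + 4 * ((2 * (1 + v)) * (2 * (1 + v)) * (v * v + 2 * v))
          ≡⟨ solve (v ∷ []) ⟩
        (2 * (1 + 2 * (v * v + 2 * v))) * (2 * (1 + 2 * (v * v + 2 * v)))
          ≡⟨ cong (λ k → (2 * k) * (2 * k)) u≡1+2r ⟨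
        (2 * u) * (2 * u)
          ≡⟨ XX≡ ⟩
        4 + 4 * d * (Y * Y)
          ≡⟨ solve (d ∷ Y ∷ []) ⟩
        4 + 4 * (d * (Y * Y))
          ∎))
      split = squarefree-split {d} {2 * (1 + v)} {v * v + 2 * v} {Y} sf (λ ()) ssr≡dYY
      b = proj₁ split
      Y≡sb = proj₁ (proj₂ split)
      r≡dbb = proj₂ (proj₂ split)

open Squares

module CurveBounds {D a₁ b₁ a b : ℕ}
  (ε-on : a₁ ℕ.* a₁ ≡ 4 ℕ.+ D ℕ.* (b₁ ℕ.* b₁)) (P-on : a ℕ.* a ≡ 4 ℕ.+ D ℕ.* (b ℕ.* b)) where

  open import Data.Nat
  open import Data.Nat.Properties
  open import Data.Nat.Tactic.RingSolver using (solve)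
  open ≤-Reasoning

  Db₁b<a₁a : D * (b₁ * b) < a₁ * a
  Db₁b<a₁a = m*m<n*n⇒m<n (begin-strict
    (D * (b₁ * b)) * (D * (b₁ * b))                                              <⟨ m<m+n _ z<s ⟩
    (D * (b₁ * b)) * (D * (b₁ * b)) + (16 + 4 * D * (b₁ * b₁) + 4 * D * (b * b)) ≡⟨ solve (D ∷ b₁ ∷ b ∷ []) ⟩
    (4 + D * (b₁ * b₁)) * (4 + D * (b * b))                                      ≡⟨ cong₂ _*_ ε-on P-on ⟨
    (a₁ * a₁) * (a * a)                                                          ≡⟨ solve (a₁ ∷ a ∷ []) ⟩
    (a₁ * a) * (a₁ * a)                                                          ∎)

  b₁a≤a₁b : b₁ ≤ b → b₁ * a ≤ a₁ * b
  b₁a≤a₁b b₁≤b = m*m≤n*n⇒m≤n (begin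
    (b₁ * a) * (b₁ * a)                       ≡⟨ solve (b₁ ∷ a ∷ []) ⟩
    (b₁ * b₁) * (a * a)                       ≡⟨ cong ((b₁ * b₁) *_) P-on ⟩
    (b₁ * b₁) * (4 + D * (b * b))             ≡⟨ solve (D ∷ b₁ ∷ b ∷ []) ⟩
    4 * (b₁ * b₁) + D * (b₁ * b₁) * (b * b)   ≤⟨ +-monoˡ-≤ _ (*-monoʳ-≤ 4 (*-mono-≤ b₁≤b b₁≤b)) ⟩
    4 * (b * b) + D * (b₁ * b₁) * (b * b)     ≡⟨ solve (D ∷ b₁ ∷ b ∷ []) ⟩
    (4 + D * (b₁ * b₁)) * (b * b)             ≡⟨ cong (_* (b * b)) ε-on ⟨
    (a₁ * a₁) * (b * b)                       ≡⟨ solve (a₁ ∷ b ∷ []) ⟩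
    (a₁ * b) * (a₁ * b)                       ∎)

  a₁b<b₁a+2b : 0 < b₁ → a₁ * b < b₁ * a + 2 * b
  a₁b<b₁a+2b 0<b₁ = begin-strict
    a₁ * b          ≡⟨ cong (_* b) a₁≡2+c ⟩
    (2 + c) * b     ≡⟨ trans (*-distribʳ-+ b 2 c) (+-comm (2 * b) (c * b)) ⟩
    c * b + 2 * b   <⟨ +-monoˡ-< (2 * b) cb<b₁a ⟩
    b₁ * a + 2 * b  ∎
    where
      a₁≥2 = ≥2-on-curve {a₁} ε-on
      c = proj₁ a₁≥2
      a₁≡2+c = proj₂ a₁≥2
      Db₁b₁≡cc+4c : D * (b₁ * b₁) ≡ c * c + 4 * c
      Db₁b₁≡cc+4c = +-cancelˡ-≡ 4 (D * (b₁ * b₁)) (c * c + 4 * c) (begin-equality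
        4 + D * (b₁ * b₁)  ≡⟨ ε-on ⟨
        a₁ * a₁            ≡⟨ cong (λ k → k * k) a₁≡2+c ⟩
        (2 + c) * (2 + c)  ≡⟨ expand c ⟩
        4 + (c * c + 4 * c) ∎)
        where expand : ∀ c → (2 + c) * (2 + c) ≡ 4 + (c * c + 4 * c)
              expand c = solve (c ∷ [])
      cb<b₁a : c * b < b₁ * a
      cb<b₁a = m*m<n*n⇒m<n (begin-strict
        (c * b) * (c * b)                                       <⟨ m<m+n _ 0<4b₁b₁+… ⟩
        (c * b) * (c * b) + (4 * (b₁ * b₁) + 4 * c * (b * b))  ≡⟨ regroup c b₁ b ⟩
        4 * (b₁ * b₁) + (c * c + 4 * c) * (b * b)
          ≡⟨ cong (λ k → 4 * (b₁ * b₁) + k * (b * b)) Db₁b₁≡cc+4c ⟨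
        4 * (b₁ * b₁) + D * (b₁ * b₁) * (b * b)                 ≡⟨ solve (D ∷ b₁ ∷ b ∷ []) ⟩
        (b₁ * b₁) * (4 + D * (b * b))                           ≡⟨ cong ((b₁ * b₁) *_) P-on ⟨
        (b₁ * b₁) * (a * a)                                     ≡⟨ solve (b₁ ∷ a ∷ []) ⟩
        (b₁ * a) * (b₁ * a)                                     ∎)
        where
          0<4b₁b₁+… : 0 < 4 * (b₁ * b₁) + 4 * c * (b * b)
          0<4b₁b₁+… = <-≤-trans (*-mono-< 0<b₁ 0<b₁) (≤-trans (m≤n*m (b₁ * b₁) 4) (m≤m+n _ _))
          regroup : ∀ c b₁ b → (c * b) * (c * b) + (4 * (b₁ * b₁) + 4 * c * (b * b))
                               ≡ 4 * (b₁ * b₁) + (c * c + 4 * c) * (b * b)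
          regroup c b₁ b = solve (c ∷ b₁ ∷ b ∷ [])

open import Data.Integer using (_+_; _*_; _-_; -_; ∣_∣; _⊖_; _<_)
open import Data.Integer.Tactic.RingSolver using (solve)

n*[n+1]-even : ∀ n → ∃ λ r → n * (n + + 1) ≡ + 2 * r
n*[n+1]-even n with n %ℕ 2 | n /ℕ 2 | a≡a%ℕn+[a/ℕn]*n n 2 | n%ℕd<d n 2
... | 0 | q | n≡2q | _ = q * (+ 2 * q + + 1) , (begin
  n * (n + + 1)                             ≡⟨ cong (λ m → m * (m + + 1)) n≡2q ⟩
  (+ 0 + q * + 2) * (+ 0 + q * + 2 + + 1)   ≡⟨ solve (q ∷ []) ⟩
  + 2 * (q * (+ 2 * q + + 1))               ∎)
  where open ≡-Reasoning
... | 1 | q | n≡2q+1 | _ = (+ 1 + + 2 * q) * (+ 1 + q) , (begin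
  n * (n + + 1)                             ≡⟨ cong (λ m → m * (m + + 1)) n≡2q+1 ⟩
  (+ 1 + q * + 2) * (+ 1 + q * + 2 + + 1)   ≡⟨ solve (q ∷ []) ⟩
  + 2 * ((+ 1 + + 2 * q) * (+ 1 + q))       ∎)
  where open ≡-Reasoning
... | suc (suc _) | _ | _ | s≤s (s≤s ())

square-abs : ∀ z → z * z ≡ + (∣ z ∣ ℕ.* ∣ z ∣)
square-abs (+ n)    = sym (ℤP.pos-* n n)
square-abs -[1+ n ] = refl

nonzero-square : ∀ {m} → m ≢ + 0 → ∃ λ k → m * m ≡ +[1+ k ] * +[1+ k ]
nonzero-square {+ zero}   m≢0 = ⊥-elim (m≢0 refl)
nonzero-square {+[1+ k ]} _   = k , refl
nonzero-square { -[1+ k ]} _  = k , refl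

halve : ∀ {z k} → + 2 * z ≡ + k → ∃ λ n → z ≡ + n × 2 ℕ.* n ≡ k
halve {+ n} 2n≡k = n , refl , ℤP.+-injective (trans (ℤP.pos-* 2 n) 2n≡k)

halve-pos : ∀ {z k} → + 2 * z ≡ + k → 0 ℕ.< k → ∃ λ n → z ≡ +[1+ n ]
halve-pos 2z≡k 0<k with halve 2z≡k
... | suc n , z≡ , _   = n , z≡
... | zero  , _  , 0≡k = ⊥-elim (ℕP.<-irrefl 0≡k 0<k)

i-j≡k⇒i≡k+j : ∀ {i j k} → i - j ≡ k → i ≡ k + j
i-j≡k⇒i≡k+j {i} {j} {k} i-j≡k = begin
  i          ≡⟨ solve (i ∷ j ∷ []) ⟩
  i - j + j  ≡⟨ cong (_+ j) i-j≡k ⟩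
  k + j      ∎
  where open ≡-Reasoning

k+j-j≡k : ∀ k j → k + j - j ≡ k
k+j-j≡k k j = solve (k ∷ j ∷ [])

record SqEqℤ (a b : ℤ) : Set where
  constructor squares
  field
    m n : ℤ
    m≢0 : m ≢ + 0
    n≢0 : n ≢ + 0
    equation : a * (m * m) ≡ b * (n * n)

module _ where
  open ≡-Reasoning

  SqEqℤ-refl : ∀ {a} → SqEqℤ a a
  SqEqℤ-refl = squares (+ 1) (+ 1) (λ ()) (λ ()) refl

  SqEqℤ-respˡ : ∀ {a b c} → a ≡ b → SqEqℤ b c → SqEqℤ a c
  SqEqℤ-respˡ refl b~c = b~c

  SqEqℤ-sym : ∀ {a b} → SqEqℤ a b → SqEqℤ b a
  SqEqℤ-sym (squares m n m≢0 n≢0 eq) = squares n m n≢0 m≢0 (sym eq)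

  *-≢0 : ∀ {m n} → m ≢ + 0 → n ≢ + 0 → m * n ≢ + 0
  *-≢0 {m} m≢0 n≢0 mn≡0 with ℤP.i*j≡0⇒i≡0∨j≡0 m mn≡0
  ... | inj₁ m≡0 = m≢0 m≡0
  ... | inj₂ n≡0 = n≢0 n≡0

  SqEqℤ-trans : ∀ {a b c} → SqEqℤ a b → SqEqℤ b c → SqEqℤ a c
  SqEqℤ-trans {a} {b} {c} (squares m n m≢0 n≢0 a≡b) (squares m′ n′ m′≢0 n′≢0 b≡c) =
    squares (m * m′) (n * n′) (*-≢0 m≢0 m′≢0) (*-≢0 n≢0 n′≢0) (begin
      a * ((m * m′) * (m * m′))     ≡⟨ solve (a ∷ m ∷ m′ ∷ []) ⟩
      (a * (m * m)) * (m′ * m′)     ≡⟨ cong (_* (m′ * m′)) a≡b ⟩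
      (b * (n * n)) * (m′ * m′)     ≡⟨ solve (b ∷ n ∷ m′ ∷ []) ⟩
      (b * (m′ * m′)) * (n * n)     ≡⟨ cong (_* (n * n)) b≡c ⟩
      (c * (n′ * n′)) * (n * n)     ≡⟨ solve (c ∷ n ∷ n′ ∷ []) ⟩
      c * ((n * n′) * (n * n′))     ∎)

  SqEqℤ-*ˡ : ∀ c {a b} → SqEqℤ a b → SqEqℤ (c * a) (c * b)
  SqEqℤ-*ˡ c {a} {b} (squares m n m≢0 n≢0 a≡b) = squares m n m≢0 n≢0 (begin
    c * a * (m * m)    ≡⟨ ℤP.*-assoc c a (m * m) ⟩
    c * (a * (m * m))  ≡⟨ cong (c *_) a≡b ⟩
    c * (b * (n * n))  ≡⟨ ℤP.*-assoc c b (n * n) ⟨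
    c * b * (n * n)    ∎)

  SqEqℤ-cancelˡ : ∀ {c a b} → c ≢ + 0 → SqEqℤ (c * a) (c * b) → SqEqℤ a b
  SqEqℤ-cancelˡ {c} {a} {b} c≢0 (squares m n m≢0 n≢0 ca≡cb) = squares m n m≢0 n≢0
    (ℤP.*-cancelˡ-≡ c (a * (m * m)) (b * (n * n)) {{ℤ.≢-nonZero c≢0}}
      (trans (sym (ℤP.*-assoc c a (m * m))) (trans ca≡cb (ℤP.*-assoc c b (n * n)))))

  SqEqℤ-*4 : ∀ a → SqEqℤ (a * + 4) a
  SqEqℤ-*4 a = squares (+ 1) (+ 2) (λ ()) (λ ()) (solve (a ∷ []))

  SqEqℤ-square : ∀ {c} → c ≢ + 0 → SqEqℤ (c * c) (+ 4)
  SqEqℤ-square {c} c≢0 = squares (+ 2) c (λ ()) c≢0 (solve (c ∷ []))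

SqEqℤ-pos-neg : ∀ {m n} → ¬ SqEqℤ +[1+ m ] -[1+ n ]
SqEqℤ-pos-neg {m} {n} (squares k l k≢0 l≢0 eq) with nonzero-square k≢0 | nonzero-square l≢0
... | p , kk≡ | q , ll≡ with trans (trans (cong (+[1+ m ] *_) (sym kk≡)) eq) (cong (-[1+ n ] *_) ll≡)
... | ()

SqEqℤ-4⇒IsSquare : ∀ {k} → SqEqℤ (+ k) (+ 4) → IsSquare k
SqEqℤ-4⇒IsSquare {k} (squares m n m≢0 _ km²≡4n²) =
  square-ratio {k} {∣ m ∣} {∣ + 2 * n ∣} (m≢0 ∘ ℤP.∣i∣≡0⇒i≡0) (ℤP.+-injective (begin
    + (k ℕ.* (∣ m ∣ ℕ.* ∣ m ∣))      ≡⟨ ℤP.pos-* k (∣ m ∣ ℕ.* ∣ m ∣) ⟩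
    + k * + (∣ m ∣ ℕ.* ∣ m ∣)        ≡⟨ cong (+ k *_) (square-abs m) ⟨
    + k * (m * m)                    ≡⟨ km²≡4n² ⟩
    + 4 * (n * n)                    ≡⟨ solve (n ∷ []) ⟩
    (+ 2 * n) * (+ 2 * n)            ≡⟨ square-abs (+ 2 * n) ⟩
    + (∣ + 2 * n ∣ ℕ.* ∣ + 2 * n ∣)   ∎))
  where open ≡-Reasoning

module _ where
  open ℚ using (mkℚ; 0ℚ; toℚᵘ; fromℚᵘ; _/_)
  open import Data.Integer.GCD using (gcd)
  open ℚP using (toℚᵘ-fromℚᵘ; toℚᵘ-homo-*; toℚᵘ-cong; toℚᵘ-injective)
  open ℚᵘP using (*-cong; *-congˡ)

  private
    strip-ones : ∀ {a b M N} → a * (+ 1 * M) ≡ b * N * + 1 → a * M ≡ b * N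
    strip-ones {a} {b} {M} {N} eq =
      trans (cong (a *_) (sym (ℤP.*-identityˡ M))) (trans eq (ℤP.*-identityʳ (b * N)))

    add-ones : ∀ {a b M N} → a * M ≡ b * N → a * (+ 1 * M) ≡ b * N * + 1
    add-ones {a} {b} {M} {N} eq =
      trans (cong (a *_) (ℤP.*-identityˡ M)) (trans eq (sym (ℤP.*-identityʳ (b * N))))

  SqEq⇒SqEqℤ : ∀ {a b} → SqEq (a / 1) (b / 1) → SqEqℤ a b
  SqEq⇒SqEqℤ {a} {b} (q@(mkℚ n d _) , q≢0 , a≡bqq) =
    squares +[1+ d ] n (λ ()) n≢0 (strip-ones {a} {b} {+[1+ d ] * +[1+ d ]} {n * n} eq)
    where
      open ℚᵘP.≃-Reasoning
      n≢0 : n ≢ + 0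
      n≢0 n≡0 = q≢0 (ℚP.↥p≡0⇒p≡0 q n≡0)
      eq : a * (+ 1 * (+[1+ d ] * +[1+ d ])) ≡ b * (n * n) * + 1
      eq with (begin
          mkℚᵘ a 0                                   ≈⟨ toℚᵘ-fromℚᵘ (mkℚᵘ a 0) ⟨
          toℚᵘ (a / 1)                               ≈⟨ toℚᵘ-cong a≡bqq ⟩
          toℚᵘ ((b / 1) ℚ.* (q ℚ.* q))                ≈⟨ toℚᵘ-homo-* (b / 1) (q ℚ.* q) ⟩
          toℚᵘ (b / 1) ℚᵘ.* toℚᵘ (q ℚ.* q)            ≈⟨ *-cong (toℚᵘ-fromℚᵘ (mkℚᵘ b 0)) (toℚᵘ-homo-* q q) ⟩
          mkℚᵘ b 0 ℚᵘ.* (mkℚᵘ n d ℚᵘ.* mkℚᵘ n d)      ∎)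
      ... | *≡* eq = eq

  SqEqℤ⇒SqEq : ∀ {a b} → SqEqℤ a b → SqEq (a / 1) (b / 1)
  SqEqℤ⇒SqEq {a} {b} (squares m n m≢0 n≢0 am²≡bn²) with nonzero-square m≢0
  ... | k , m²≡ = q , q≢0 , toℚᵘ-injective (begin
      toℚᵘ (a / 1)                            ≈⟨ toℚᵘ-fromℚᵘ (mkℚᵘ a 0) ⟩
      mkℚᵘ a 0
        ≈⟨ *≡* (add-ones {a} {b} {+[1+ k ] * +[1+ k ]} {n * n} (trans (cong (a *_) (sym m²≡)) am²≡bn²)) ⟩
      mkℚᵘ b 0 ℚᵘ.* (mkℚᵘ n k ℚᵘ.* mkℚᵘ n k)
        ≈⟨ *-cong (toℚᵘ-fromℚᵘ (mkℚᵘ b 0)) (*-cong (toℚᵘ-fromℚᵘ (mkℚᵘ n k)) (toℚᵘ-fromℚᵘ (mkℚᵘ n k))) ⟨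
      toℚᵘ (b / 1) ℚᵘ.* (toℚᵘ q ℚᵘ.* toℚᵘ q)    ≈⟨ *-congˡ {toℚᵘ (b / 1)} (toℚᵘ-homo-* q q) ⟨
      toℚᵘ (b / 1) ℚᵘ.* toℚᵘ (q ℚ.* q)          ≈⟨ toℚᵘ-homo-* (b / 1) (q ℚ.* q) ⟨
      toℚᵘ ((b / 1) ℚ.* (q ℚ.* q))              ∎)
    where
      open ℚᵘP.≃-Reasoning
      q = n / suc k
      q≢0 : q ≢ 0ℚ
      q≢0 q≡0 = n≢0 (trans (sym (ℚP.↥-/ n (suc k))) (cong (λ p → ℚ.↥ p * gcd n (+ suc k)) q≡0))

x+2-identity : ∀ A B C Z → + 2 * C ≡ A * B + Z → Z * Z ≡ (A * A - + 4) * (B * B - + 4) →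
               (A + + 2) * (B + + 2) * (C + + 2) ≡ (+ 2 + A + B + C) * (+ 2 + A + B + C)
x+2-identity A B C Z 2C≡AB+Z Z²≡ =
  ℤP.*-cancelˡ-≡ (+ 4) ((A + + 2) * (B + + 2) * (C + + 2)) ((+ 2 + A + B + C) * (+ 2 + A + B + C)) (begin
    + 4 * ((A + + 2) * (B + + 2) * (C + + 2))
      ≡⟨ solve (A ∷ B ∷ C ∷ []) ⟩
    (A + + 2) * (B + + 2) * (+ 2 * (+ 2 * C) + + 8)
      ≡⟨ cong (λ k → (A + + 2) * (B + + 2) * (+ 2 * k + + 8)) 2C≡AB+Z ⟩
    (A + + 2) * (B + + 2) * (+ 2 * (A * B + Z) + + 8)
      ≡⟨ solve (A ∷ B ∷ Z ∷ []) ⟩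
    (+ 4 + + 2 * A + + 2 * B + (A * B + Z)) * (+ 4 + + 2 * A + + 2 * B + (A * B + Z)) - (Z * Z - (A * A - + 4) * (B * B - + 4))
      ≡⟨ cong (λ k → (+ 4 + + 2 * A + + 2 * B + (A * B + Z)) * (+ 4 + + 2 * A + + 2 * B + (A * B + Z)) - (Z * Z - k)) Z²≡ ⟨
    (+ 4 + + 2 * A + + 2 * B + (A * B + Z)) * (+ 4 + + 2 * A + + 2 * B + (A * B + Z)) - (Z * Z - Z * Z)
      ≡⟨ solve (A ∷ B ∷ Z ∷ []) ⟩
    (+ 4 + + 2 * A + + 2 * B + (A * B + Z)) * (+ 4 + + 2 * A + + 2 * B + (A * B + Z))
      ≡⟨ cong (λ k → (+ 4 + + 2 * A + + 2 * B + k) * (+ 4 + + 2 * A + + 2 * B + k)) 2C≡AB+Z ⟨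
    (+ 4 + + 2 * A + + 2 * B + + 2 * C) * (+ 4 + + 2 * A + + 2 * B + + 2 * C)
      ≡⟨ solve (A ∷ B ∷ C ∷ []) ⟩
    + 4 * ((+ 2 + A + B + C) * (+ 2 + A + B + C))
      ∎)
  where open ≡-Reasoning

pigeonhole-3-2 : ∀ {A : Set} {u w a b c : A} → a ≡ u ⊎ a ≡ w → b ≡ u ⊎ b ≡ w → c ≡ u ⊎ c ≡ w →
                 a ≡ b ⊎ a ≡ c ⊎ b ≡ c
pigeonhole-3-2 (inj₁ refl) (inj₁ refl) _           = inj₁ refl
pigeonhole-3-2 (inj₂ refl) (inj₂ refl) _           = inj₁ refl
pigeonhole-3-2 (inj₁ refl) (inj₂ refl) (inj₁ refl) = inj₂ (inj₁ refl)
pigeonhole-3-2 (inj₁ refl) (inj₂ refl) (inj₂ refl) = inj₂ (inj₂ refl)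
pigeonhole-3-2 (inj₂ refl) (inj₁ refl) (inj₁ refl) = inj₂ (inj₂ refl)
pigeonhole-3-2 (inj₂ refl) (inj₁ refl) (inj₂ refl) = inj₂ (inj₁ refl)

module IntegerMultiples {c ℓ} (G : AbelianGroup c ℓ) where

  open AbelianGroup G renaming (refl to ≈-refl; sym to ≈-sym; trans to ≈-trans)
  open import Algebra.Properties.AbelianGroup G using (ε⁻¹≈ε; ⁻¹-∙-comm)
  open import Algebra.Properties.CommutativeSemigroup commutativeSemigroup using (interchange)
  open import Algebra.Definitions.RawMonoid rawMonoid public using () renaming (_×_ to _×ℕ_)
  open import Algebra.Properties.Monoid.Mult monoid using (×-homo-+)
  open import Relation.Binary.Reasoning.Setoid setoid

  infixr 8 _·_

  _·_ : ℤ → Carrier → Carrier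
  (+ n)    · g = n ×ℕ g
  -[1+ n ] · g = (suc n ×ℕ g) ⁻¹

  ·-⊖ : ∀ m n g → (m ⊖ n) · g ≈ m ×ℕ g ∙ (n ×ℕ g) ⁻¹
  ·-⊖ m       zero    g = begin
    m ×ℕ g             ≈⟨ identityʳ (m ×ℕ g) ⟨
    m ×ℕ g ∙ ε         ≈⟨ ∙-congˡ ε⁻¹≈ε ⟨
    m ×ℕ g ∙ ε ⁻¹      ∎
  ·-⊖ zero    (suc n) g = ≈-sym (identityˡ _)
  ·-⊖ (suc m) (suc n) g = begin
    (suc m ⊖ suc n) · g                ≡⟨ cong (_· g) (ℤP.[1+m]⊖[1+n]≡m⊖n m n) ⟩
    (m ⊖ n) · g                        ≈⟨ ·-⊖ m n g ⟩
    m ×ℕ g ∙ (n ×ℕ g) ⁻¹                 ≈⟨ identityˡ _ ⟨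
    ε ∙ (m ×ℕ g ∙ (n ×ℕ g) ⁻¹)           ≈⟨ ∙-congʳ (inverseʳ g) ⟨
    g ∙ g ⁻¹ ∙ (m ×ℕ g ∙ (n ×ℕ g) ⁻¹)    ≈⟨ interchange g (g ⁻¹) (m ×ℕ g) ((n ×ℕ g) ⁻¹) ⟩
    g ∙ m ×ℕ g ∙ (g ⁻¹ ∙ (n ×ℕ g) ⁻¹)    ≈⟨ ∙-congˡ (⁻¹-∙-comm g (n ×ℕ g)) ⟩
    suc m ×ℕ g ∙ (suc n ×ℕ g) ⁻¹         ∎

  ·-homo-+ : ∀ i j g → (i + j) · g ≈ i · g ∙ j · g
  ·-homo-+ (+ m)    (+ n)    g = ×-homo-+ g m n
  ·-homo-+ (+ m)    -[1+ n ] g = ·-⊖ m (suc n) g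
  ·-homo-+ -[1+ m ] (+ n)    g = ≈-trans (·-⊖ n (suc m) g) (comm _ _)
  ·-homo-+ -[1+ m ] -[1+ n ] g = begin
    (suc (suc m ℕ.+ n) ×ℕ g) ⁻¹         ≡⟨ cong (λ k → (suc k ×ℕ g) ⁻¹) (ℕP.+-suc m n) ⟨
    ((suc m ℕ.+ suc n) ×ℕ g) ⁻¹         ≈⟨ ⁻¹-cong (×-homo-+ g (suc m) (suc n)) ⟩
    (suc m ×ℕ g ∙ suc n ×ℕ g) ⁻¹         ≈⟨ ⁻¹-∙-comm (suc m ×ℕ g) (suc n ×ℕ g) ⟨
    (suc m ×ℕ g) ⁻¹ ∙ (suc n ×ℕ g) ⁻¹    ∎

  -ℕ·≈⁻¹ : ∀ n g → (- (+ n)) · g ≈ (n ×ℕ g) ⁻¹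
  -ℕ·≈⁻¹ zero    g = ≈-sym ε⁻¹≈ε
  -ℕ·≈⁻¹ (suc n) g = ≈-refl

module CurveGroup (Δ : ℤ) where

  open ≡-Reasoning

  Pt-≡ : ∀ {P Q : Pt Δ} → x P ≡ x Q → y P ≡ y Q → P ≡ Q
  Pt-≡ {pt _ _ _} {pt _ _ _} refl refl = refl

  on-curve : (P : Pt Δ) → x P * x P - Δ * (y P * y P) ≡ + 4
  on-curve (pt a b h) = recompute (a * a - Δ * (b * b) ℤ.≟ + 4) h

  -- This parity makes the halves in the addition law integers.
  x≡Δy[mod2] : (P : Pt Δ) → ∃ λ s → x P ≡ Δ * y P + + 2 * s
  x≡Δy[mod2] P@(pt a b _) with n*[n+1]-even (a - + 1) | n*[n+1]-even (b - + 1)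
  ... | r , a[a-1]≡2r | t , b[b-1]≡2t = + 2 - r + Δ * t , (begin
    a
      ≡⟨ solve (a ∷ b ∷ Δ ∷ []) ⟩
    Δ * b + ((a * a - Δ * (b * b)) - (a - + 1) * (a - + 1 + + 1) + Δ * ((b - + 1) * (b - + 1 + + 1)))
      ≡⟨ cong₂ (λ u v → Δ * b + (u - v + Δ * ((b - + 1) * (b - + 1 + + 1)))) (on-curve P) a[a-1]≡2r ⟩
    Δ * b + (+ 4 - + 2 * r + Δ * ((b - + 1) * (b - + 1 + + 1)))
      ≡⟨ cong (λ w → Δ * b + (+ 4 - + 2 * r + Δ * w)) b[b-1]≡2t ⟩
    Δ * b + (+ 4 - + 2 * r + Δ * (+ 2 * t))
      ≡⟨ solve (Δ ∷ b ∷ r ∷ t ∷ []) ⟩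
    Δ * b + + 2 * (+ 2 - r + Δ * t)
      ∎)

  ⊞x-half : (P Q : Pt Δ) → ∃ λ h → + 2 * h ≡ x P * x Q + Δ * (y P * y Q)
  ⊞x-half P@(pt _ b _) Q@(pt _ d _) with x≡Δy[mod2] P | x≡Δy[mod2] Q | n*[n+1]-even Δ
  ... | s , refl | t , refl | r , Δ[Δ+1]≡2r = r * (b * d) + (Δ * b * t + s * Δ * d + + 2 * s * t) , (begin
    + 2 * (r * (b * d) + (Δ * b * t + s * Δ * d + + 2 * s * t))
      ≡⟨ solve (r ∷ b ∷ d ∷ Δ ∷ s ∷ t ∷ []) ⟩
    + 2 * r * (b * d) + + 2 * (Δ * b * t + s * Δ * d + + 2 * s * t)
      ≡⟨ cong (λ k → k * (b * d) + + 2 * (Δ * b * t + s * Δ * d + + 2 * s * t)) Δ[Δ+1]≡2r ⟨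
    Δ * (Δ + + 1) * (b * d) + + 2 * (Δ * b * t + s * Δ * d + + 2 * s * t)
      ≡⟨ solve (Δ ∷ b ∷ d ∷ s ∷ t ∷ []) ⟩
    (Δ * b + + 2 * s) * (Δ * d + + 2 * t) + Δ * (b * d)
      ∎)

  ⊞y-half : (P Q : Pt Δ) → ∃ λ h → + 2 * h ≡ x P * y Q + y P * x Q
  ⊞y-half P@(pt _ b _) Q@(pt _ d _) with x≡Δy[mod2] P | x≡Δy[mod2] Q
  ... | s , refl | t , refl = Δ * b * d + s * d + b * t , (begin
    + 2 * (Δ * b * d + s * d + b * t)                   ≡⟨ solve (Δ ∷ b ∷ d ∷ s ∷ t ∷ []) ⟩
    (Δ * b + + 2 * s) * d + b * (Δ * d + + 2 * t)       ∎)

  halves-on-curve : (P Q : Pt Δ) {X Y : ℤ} →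
                    + 2 * X ≡ x P * x Q + Δ * (y P * y Q) → + 2 * Y ≡ x P * y Q + y P * x Q →
                    X * X - Δ * (Y * Y) ≡ + 4
  halves-on-curve P@(pt a b _) Q@(pt c d _) {X} {Y} 2X≡ 2Y≡ =
    ℤP.*-cancelˡ-≡ (+ 4) (X * X - Δ * (Y * Y)) (+ 4) (begin
      + 4 * (X * X - Δ * (Y * Y))
        ≡⟨ solve (X ∷ Y ∷ Δ ∷ []) ⟩
      (+ 2 * X) * (+ 2 * X) - Δ * ((+ 2 * Y) * (+ 2 * Y))
        ≡⟨ cong₂ (λ u v → u * u - Δ * (v * v)) 2X≡ 2Y≡ ⟩
      (a * c + Δ * (b * d)) * (a * c + Δ * (b * d)) - Δ * ((a * d + b * c) * (a * d + b * c))
        ≡⟨ solve (a ∷ b ∷ c ∷ d ∷ Δ ∷ []) ⟩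
      (a * a - Δ * (b * b)) * (c * c - Δ * (d * d))
        ≡⟨ cong₂ _*_ (on-curve P) (on-curve Q) ⟩
      + 4 * + 4
        ∎)

  opaque
    infixl 6 _⊞_
    _⊞_ : Pt Δ → Pt Δ → Pt Δ
    P ⊞ Q = pt (proj₁ (⊞x-half P Q)) (proj₁ (⊞y-half P Q))
               (halves-on-curve P Q (proj₂ (⊞x-half P Q)) (proj₂ (⊞y-half P Q)))

    ⊞-isSum : ∀ P Q → IsSum Δ P Q (P ⊞ Q)
    ⊞-isSum P Q = proj₂ (⊞x-half P Q) , proj₂ (⊞y-half P Q)

  IsSum⇒≡⊞ : ∀ {P Q R} → IsSum Δ P Q R → R ≡ P ⊞ Q
  IsSum⇒≡⊞ {P} {Q} (2x≡ , 2y≡) = Pt-≡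
    (ℤP.*-cancelˡ-≡ (+ 2) _ _ (trans 2x≡ (sym (proj₁ (⊞-isSum P Q)))))
    (ℤP.*-cancelˡ-≡ (+ 2) _ _ (trans 2y≡ (sym (proj₂ (⊞-isSum P Q)))))

  O T : Pt Δ
  O = pt (+ 2) (+ 0) (cong (λ k → + 4 - k) (ℤP.*-zeroʳ Δ))
  T = pt (- + 2) (+ 0) (cong (λ k → + 4 - k) (ℤP.*-zeroʳ Δ))

  infix 8 ⊟_
  ⊟_ : Pt Δ → Pt Δ
  ⊟ P@(pt a b _) = pt a (- b) (begin
    a * a - Δ * (- b * - b)  ≡⟨ solve (a ∷ b ∷ Δ ∷ []) ⟩
    a * a - Δ * (b * b)      ≡⟨ on-curve P ⟩
    + 4                      ∎)

  IsSum-comm : ∀ {P Q R} → IsSum Δ P Q R → IsSum Δ Q P R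
  IsSum-comm {pt a b _} {pt c d _} (2x≡ , 2y≡) =
    trans 2x≡ (solve (a ∷ b ∷ c ∷ d ∷ Δ ∷ [])) , trans 2y≡ (solve (a ∷ b ∷ c ∷ d ∷ []))

  ⊞-comm : ∀ P Q → P ⊞ Q ≡ Q ⊞ P
  ⊞-comm P Q = IsSum⇒≡⊞ {Q} {P} (IsSum-comm {P} {Q} {P ⊞ Q} (⊞-isSum P Q))

  ⊞-identityˡ : ∀ P → O ⊞ P ≡ P
  ⊞-identityˡ P@(pt a b _) = sym (IsSum⇒≡⊞ {O} {P}
    ( sym (trans (cong (λ k → + 2 * a + k) (ℤP.*-zeroʳ Δ)) (ℤP.+-identityʳ (+ 2 * a)))
    , sym (ℤP.+-identityʳ (+ 2 * b))))

  ⊞-identityʳ : ∀ P → P ⊞ O ≡ P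
  ⊞-identityʳ P = trans (⊞-comm P O) (⊞-identityˡ P)

  ⊞-inverseʳ : ∀ P → P ⊞ ⊟ P ≡ O
  ⊞-inverseʳ P@(pt a b _) = sym (IsSum⇒≡⊞ {P} {⊟ P} (2x≡ , 2y≡))
    where
      2y≡ : + 2 * + 0 ≡ a * - b + b * a
      2y≡ = solve (a ∷ b ∷ [])
      2x≡ : + 2 * + 2 ≡ a * a + Δ * (b * - b)
      2x≡ = begin
        + 2 * + 2                 ≡⟨ on-curve P ⟨
        a * a - Δ * (b * b)       ≡⟨ solve (a ∷ b ∷ Δ ∷ []) ⟩
        a * a + Δ * (b * - b)     ∎

  ⊞-inverseˡ : ∀ P → ⊟ P ⊞ P ≡ O
  ⊞-inverseˡ P = trans (⊞-comm (⊟ P) P) (⊞-inverseʳ P)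

  private
    reassociate-x : ∀ a b c d e f {xA yA xB yB} →
      + 2 * xA ≡ a * c + Δ * (b * d) → + 2 * yA ≡ a * d + b * c →
      + 2 * xB ≡ c * e + Δ * (d * f) → + 2 * yB ≡ c * f + d * e →
      xA * e + Δ * (yA * f) ≡ a * xB + Δ * (b * yB)
    reassociate-x a b c d e f {xA} {yA} {xB} {yB} 2xA≡ 2yA≡ 2xB≡ 2yB≡ = ℤP.*-cancelˡ-≡ (+ 2) _ _ (begin
      + 2 * (xA * e + Δ * (yA * f))                                ≡⟨ solve (xA ∷ yA ∷ e ∷ f ∷ Δ ∷ []) ⟩
      (+ 2 * xA) * e + Δ * ((+ 2 * yA) * f)                        ≡⟨ cong₂ (λ u v → u * e + Δ * (v * f)) 2xA≡ 2yA≡ ⟩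
      (a * c + Δ * (b * d)) * e + Δ * ((a * d + b * c) * f)        ≡⟨ solve (a ∷ b ∷ c ∷ d ∷ e ∷ f ∷ Δ ∷ []) ⟩
      a * (c * e + Δ * (d * f)) + Δ * (b * (c * f + d * e))        ≡⟨ cong₂ (λ u v → a * u + Δ * (b * v)) 2xB≡ 2yB≡ ⟨
      a * (+ 2 * xB) + Δ * (b * (+ 2 * yB))                        ≡⟨ solve (a ∷ b ∷ xB ∷ yB ∷ Δ ∷ []) ⟩
      + 2 * (a * xB + Δ * (b * yB))                                ∎)

    reassociate-y : ∀ a b c d e f {xA yA xB yB} →
      + 2 * xA ≡ a * c + Δ * (b * d) → + 2 * yA ≡ a * d + b * c →
      + 2 * xB ≡ c * e + Δ * (d * f) → + 2 * yB ≡ c * f + d * e →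
      xA * f + yA * e ≡ a * yB + b * xB
    reassociate-y a b c d e f {xA} {yA} {xB} {yB} 2xA≡ 2yA≡ 2xB≡ 2yB≡ = ℤP.*-cancelˡ-≡ (+ 2) _ _ (begin
      + 2 * (xA * f + yA * e)                                      ≡⟨ solve (xA ∷ yA ∷ e ∷ f ∷ []) ⟩
      (+ 2 * xA) * f + (+ 2 * yA) * e                              ≡⟨ cong₂ (λ u v → u * f + v * e) 2xA≡ 2yA≡ ⟩
      (a * c + Δ * (b * d)) * f + (a * d + b * c) * e              ≡⟨ solve (a ∷ b ∷ c ∷ d ∷ e ∷ f ∷ Δ ∷ []) ⟩
      a * (c * f + d * e) + b * (c * e + Δ * (d * f))              ≡⟨ cong₂ (λ u v → a * u + b * v) 2yB≡ 2xB≡ ⟨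
      a * (+ 2 * yB) + b * (+ 2 * xB)                              ≡⟨ solve (a ∷ b ∷ xB ∷ yB ∷ []) ⟩
      + 2 * (a * yB + b * xB)                                      ∎)

  ⊞-assoc : ∀ P Q R → (P ⊞ Q) ⊞ R ≡ P ⊞ (Q ⊞ R)
  ⊞-assoc P@(pt a b _) Q@(pt c d _) R@(pt e f _) = IsSum⇒≡⊞ {P} {Q ⊞ R}
    ( trans 2x≡ (reassociate-x a b c d e f 2xA≡ 2yA≡ 2xB≡ 2yB≡)
    , trans 2y≡ (reassociate-y a b c d e f 2xA≡ 2yA≡ 2xB≡ 2yB≡))
    where
      2xA≡ = proj₁ (⊞-isSum P Q)
      2yA≡ = proj₂ (⊞-isSum P Q)
      2xB≡ = proj₁ (⊞-isSum Q R)
      2yB≡ = proj₂ (⊞-isSum Q R)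
      2x≡ = proj₁ (⊞-isSum (P ⊞ Q) R)
      2y≡ = proj₂ (⊞-isSum (P ⊞ Q) R)

  ⊞-isAbelianGroup : IsAbelianGroup _≡_ _⊞_ O ⊟_
  ⊞-isAbelianGroup = record
    { isGroup = record
      { isMonoid = record
        { isSemigroup = record { isMagma = isMagma _⊞_ ; assoc = ⊞-assoc }
        ; identity    = ⊞-identityˡ , ⊞-identityʳ
        }
      ; inverse = ⊞-inverseˡ , ⊞-inverseʳ
      ; ⁻¹-cong = cong ⊟_
      }
    ; comm = ⊞-comm
    }

  curveGroup : AbelianGroup 0ℓ 0ℓ
  curveGroup = record { isAbelianGroup = ⊞-isAbelianGroup }

  open import Algebra.Properties.CommutativeSemigroup (AbelianGroup.commutativeSemigroup curveGroup)
    using (interchange; x∙yz≈y∙xz)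

  T⊞T≡O : T ⊞ T ≡ O
  T⊞T≡O = sym (IsSum⇒≡⊞ {T} {T} (sym (cong (λ k → + 4 + k) (ℤP.*-zeroʳ Δ)) , refl))

  private
    -2*≡2*- : ∀ a → - + 2 * a ≡ + 2 * - a
    -2*≡2*- a = trans (sym (ℤP.neg-distribˡ-* (+ 2) a)) (ℤP.neg-distribʳ-* (+ 2) a)

  x-T⊞ : ∀ P → x (T ⊞ P) ≡ - x P
  x-T⊞ P@(pt a b _) = ℤP.*-cancelˡ-≡ (+ 2) (x (T ⊞ P)) (- a) (begin
    + 2 * x (T ⊞ P)          ≡⟨ proj₁ (⊞-isSum T P) ⟩
    - + 2 * a + Δ * + 0      ≡⟨ cong (λ k → - + 2 * a + k) (ℤP.*-zeroʳ Δ) ⟩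
    - + 2 * a + + 0          ≡⟨ ℤP.+-identityʳ (- + 2 * a) ⟩
    - + 2 * a                ≡⟨ -2*≡2*- a ⟩
    + 2 * - a                ∎)

  T⊞T⊞ : ∀ P → T ⊞ (T ⊞ P) ≡ P
  T⊞T⊞ P = begin
    T ⊞ (T ⊞ P)   ≡⟨ ⊞-assoc T T P ⟨
    T ⊞ T ⊞ P     ≡⟨ cong (_⊞ P) T⊞T≡O ⟩
    O ⊞ P         ≡⟨ ⊞-identityˡ P ⟩
    P             ∎

  plusT : Bool → Pt Δ → Pt Δ
  plusT false P = P
  plusT true  P = T ⊞ P

  plusT-⊞ : ∀ a b P Q → plusT a P ⊞ plusT b Q ≡ plusT (a xor b) (P ⊞ Q)
  plusT-⊞ false false P Q = refl
  plusT-⊞ false true  P Q = x∙yz≈y∙xz P T Q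
  plusT-⊞ true  false P Q = ⊞-assoc T P Q
  plusT-⊞ true  true  P Q = begin
    (T ⊞ P) ⊞ (T ⊞ Q)   ≡⟨ interchange T P T Q ⟩
    (T ⊞ T) ⊞ (P ⊞ Q)   ≡⟨ cong (_⊞ (P ⊞ Q)) T⊞T≡O ⟩
    O ⊞ (P ⊞ Q)         ≡⟨ ⊞-identityˡ (P ⊞ Q) ⟩
    P ⊞ Q               ∎

  y≡0⇒O⊎T : ∀ P → y P ≡ + 0 → P ≡ O ⊎ P ≡ T
  y≡0⇒O⊎T P@(pt a _ _) refl with ∣a∣≡2
    where
      ∣a∣≡2 : ∣ a ∣ ≡ 2
      ∣a∣≡2 = m*m≡n*n⇒m≡n (ℤP.+-injective (begin
        + (∣ a ∣ ℕ.* ∣ a ∣)   ≡⟨ square-abs a ⟨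
        a * a                 ≡⟨ solve (a ∷ Δ ∷ []) ⟩
        a * a - Δ * + 0       ≡⟨ on-curve P ⟩
        + 4                   ∎))
  y≡0⇒O⊎T (pt (+ _) _ _)      refl | refl = inj₁ refl
  y≡0⇒O⊎T (pt -[1+ _ ] _ _)  refl | refl = inj₂ refl

  distinct⇒y≢0 : ∀ P Q R → P ≢ Q → P ≢ R → Q ≢ R → ∃ λ S → y S ≢ + 0
  distinct⇒y≢0 P Q R P≢Q P≢R Q≢R with y P ℤ.≟ + 0 | y Q ℤ.≟ + 0 | y R ℤ.≟ + 0
  ... | no  y≢0 | _         | _         = P , y≢0
  ... | yes _   | no  y≢0   | _         = Q , y≢0
  ... | yes _   | yes _     | no  y≢0   = R , y≢0
  ... | yes yP  | yes yQ    | yes yR    =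
    ⊥-elim ([ P≢Q , [ P≢R , Q≢R ]′ ]′ (pigeonhole-3-2 (y≡0⇒O⊎T P yP) (y≡0⇒O⊎T Q yQ) (y≡0⇒O⊎T R yR)))

  αℤ : Pt Δ → ℤ
  αℤ P with x P ℤ.≟ - + 2
  ... | yes _ = - Δ
  ... | no  _ = x P + + 2

  α≡αℤ/1 : ∀ P → α Δ P ≡ αℤ P ℚ./ 1
  α≡αℤ/1 P with x P ℤ.≟ - + 2
  ... | yes _ = refl
  ... | no  _ = refl

  αℤ-x≡-2 : ∀ {P} → x P ≡ - + 2 → αℤ P ≡ - Δ
  αℤ-x≡-2 {P} x≡-2 with x P ℤ.≟ - + 2
  ... | yes _    = refl
  ... | no  x≢-2 = ⊥-elim (x≢-2 x≡-2)

  αℤ-x≢-2 : ∀ {P} → x P ≢ - + 2 → αℤ P ≡ x P + + 2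
  αℤ-x≢-2 {P} x≢-2 with x P ℤ.≟ - + 2
  ... | yes x≡-2 = ⊥-elim (x≢-2 x≡-2)
  ... | no  _    = refl

  αℤ-x>0 : ∀ {P a} → x P ≡ +[1+ a ] → αℤ P ≡ x P + + 2
  αℤ-x>0 x≡ = αℤ-x≢-2 (λ x≡-2 → +≢- (trans (sym x≡) x≡-2))
    where
      +≢- : ∀ {m n} → +[1+ m ] ≢ -[1+ n ]
      +≢- ()

  Δy²≡x²-4 : ∀ P → Δ * (y P * y P) ≡ x P * x P - + 4
  Δy²≡x²-4 P@(pt a b _) = begin
    Δ * (b * b)                  ≡⟨ solve (a ∷ b ∷ Δ ∷ []) ⟩
    a * a - (a * a - Δ * (b * b)) ≡⟨ cong (λ k → a * a - k) (on-curve P) ⟩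
    a * a - + 4                  ∎

  -- This makes x + 2, the value of α away from x = −2, multiplicative up to squares.
  x+2-product : ∀ {P Q R} → IsSum Δ P Q R →
    (x P + + 2) * (x Q + + 2) * (x R + + 2) ≡ (+ 2 + x P + x Q + x R) * (+ 2 + x P + x Q + x R)
  x+2-product {P@(pt A b _)} {Q@(pt B d _)} {pt C _ _} (2C≡ , _) = x+2-identity A B C (Δ * (b * d)) 2C≡ (begin
    Δ * (b * d) * (Δ * (b * d))     ≡⟨ solve (b ∷ d ∷ Δ ∷ []) ⟩
    Δ * (b * b) * (Δ * (d * d))     ≡⟨ cong₂ _*_ (Δy²≡x²-4 P) (Δy²≡x²-4 Q) ⟩
    (A * A - + 4) * (B * B - + 4)   ∎)

  x+2-class-⊞ : ∀ {P Q R} → IsSum Δ P Q R →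
    x P + + 2 ≢ + 0 → x Q + + 2 ≢ + 0 → + 2 + x P + x Q + x R ≢ + 0 →
    SqEqℤ (x R + + 2) ((x P + + 2) * (x Q + + 2))
  x+2-class-⊞ {P@(pt A _ _)} {Q@(pt B _ _)} {R@(pt C _ _)} s A+2≢0 B+2≢0 S≢0 =
    squares ((A + + 2) * (B + + 2)) (+ 2 + A + B + C) (*-≢0 A+2≢0 B+2≢0) S≢0 (begin
      (C + + 2) * (((A + + 2) * (B + + 2)) * ((A + + 2) * (B + + 2)))   ≡⟨ solve (A ∷ B ∷ C ∷ []) ⟩
      (A + + 2) * (B + + 2) * ((A + + 2) * (B + + 2) * (C + + 2))
        ≡⟨ cong ((A + + 2) * (B + + 2) *_) (x+2-product {P} {Q} {R} s) ⟩
      (A + + 2) * (B + + 2) * ((+ 2 + A + B + C) * (+ 2 + A + B + C))   ∎)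

  2-x-class : ∀ P → y P ≢ + 0 → x P + + 2 ≢ + 0 → SqEqℤ (- x P + + 2) (- Δ * (x P + + 2))
  2-x-class P@(pt a b _) b≢0 a+2≢0 = squares (a + + 2) b a+2≢0 b≢0 (begin
    (- a + + 2) * ((a + + 2) * (a + + 2))   ≡⟨ solve (a ∷ []) ⟩
    - (a + + 2) * (a * a - + 4)             ≡⟨ cong (λ k → - (a + + 2) * k) (Δy²≡x²-4 P) ⟨
    - (a + + 2) * (Δ * (b * b))             ≡⟨ solve (a ∷ b ∷ Δ ∷ []) ⟩
    - Δ * (a + + 2) * (b * b)               ∎)

module PositiveDiscriminant (D : ℕ) .{{_ : ℕ.NonZero D}} (halving : Halving D) where
  open CurveGroup (+ D)
  open IntegerMultiples curveGroup using (_×ℕ_; _·_; ·-homo-+; -ℕ·≈⁻¹)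
  open import Data.Nat using (_<?_)
  open ≡-Reasoning

  on-curve-ℕ : (P : Pt (+ D)) → ∣ x P ∣ ℕ.* ∣ x P ∣ ≡ 4 ℕ.+ D ℕ.* (∣ y P ∣ ℕ.* ∣ y P ∣)
  on-curve-ℕ P@(pt a b _) = ℤP.+-injective (begin
    + (∣ a ∣ ℕ.* ∣ a ∣)                ≡⟨ square-abs a ⟨
    a * a                              ≡⟨ i-j≡k⇒i≡k+j (on-curve P) ⟩
    + 4 + + D * (b * b)                ≡⟨ cong (λ k → + 4 + + D * k) (square-abs b) ⟩
    + 4 + + D * + (∣ b ∣ ℕ.* ∣ b ∣)      ≡⟨ cong (λ k → + 4 + k) (ℤP.pos-* D (∣ b ∣ ℕ.* ∣ b ∣)) ⟨
    + (4 ℕ.+ D ℕ.* (∣ b ∣ ℕ.* ∣ b ∣))    ∎)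

  ptℕ : ∀ a b → a ℕ.* a ≡ 4 ℕ.+ D ℕ.* (b ℕ.* b) → Pt (+ D)
  ptℕ a b on = pt (+ a) (+ b) (begin
    + a * + a - + D * (+ b * + b)                    ≡⟨ cong₂ (λ u v → u - + D * v) (ℤP.pos-* a a) (ℤP.pos-* b b) ⟨
    + (a ℕ.* a) - + D * + (b ℕ.* b)                  ≡⟨ cong (λ k → + (a ℕ.* a) - k) (ℤP.pos-* D (b ℕ.* b)) ⟨
    + (a ℕ.* a) - + (D ℕ.* (b ℕ.* b))                ≡⟨ cong (λ k → + k - + (D ℕ.* (b ℕ.* b))) on ⟩
    + 4 + + (D ℕ.* (b ℕ.* b)) - + (D ℕ.* (b ℕ.* b))  ≡⟨ k+j-j≡k (+ 4) (+ (D ℕ.* (b ℕ.* b))) ⟩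
    + 4                                              ∎)

  x≢0 : ∀ P → x P ≢ + 0
  x≢0 P x≡0 = ℕP.0≢1+n (trans (cong (λ z → ∣ z ∣ ℕ.* ∣ z ∣) (sym x≡0)) (on-curve-ℕ P))

  x>0∧y≡0⇒O : ∀ P {a} → x P ≡ +[1+ a ] → y P ≡ + 0 → P ≡ O
  x>0∧y≡0⇒O P x≡ y≡0 with y≡0⇒O⊎T P y≡0
  ... | inj₁ P≡O = P≡O
  ... | inj₂ refl with x≡
  ... | ()

  module Generator {a₁ b₁ : ℕ} (ε-on : a₁ ℕ.* a₁ ≡ 4 ℕ.+ D ℕ.* (b₁ ℕ.* b₁)) (0<b₁ : 0 ℕ.< b₁)
                   (b₁-least : ∀ (P : Pt (+ D)) {b} → y P ≡ +[1+ b ] → b₁ ℕ.≤ suc b) where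

    ε : Pt (+ D)
    ε = ptℕ a₁ b₁ ε-on

    private
      +*+ : ∀ m n → + m * + n ≡ + (m ℕ.* n)
      +*+ m n = sym (ℤP.pos-* m n)

      on-curve-coords : ∀ P {a b} → x P ≡ + a → y P ≡ + b → a ℕ.* a ≡ 4 ℕ.+ D ℕ.* (b ℕ.* b)
      on-curve-coords P x≡ y≡ =
        subst₂ (λ u v → u ℕ.* u ≡ 4 ℕ.+ D ℕ.* (v ℕ.* v)) (cong ∣_∣ x≡) (cong ∣_∣ y≡) (on-curve-ℕ P)

    ε⊞-x : ∀ P {a b} → x P ≡ + a → y P ≡ + b → + 2 * x (ε ⊞ P) ≡ + (a₁ ℕ.* a ℕ.+ D ℕ.* (b₁ ℕ.* b))
    ε⊞-x P {a} {b} x≡ y≡ = begin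
      + 2 * x (ε ⊞ P)                       ≡⟨ proj₁ (⊞-isSum ε P) ⟩
      + a₁ * x P + + D * (+ b₁ * y P)       ≡⟨ cong₂ (λ u v → + a₁ * u + + D * (+ b₁ * v)) x≡ y≡ ⟩
      + a₁ * + a + + D * (+ b₁ * + b)       ≡⟨ cong₂ (λ u v → u + + D * v) (+*+ a₁ a) (+*+ b₁ b) ⟩
      + (a₁ ℕ.* a) + + D * + (b₁ ℕ.* b)     ≡⟨ cong (λ k → + (a₁ ℕ.* a) + k) (+*+ D (b₁ ℕ.* b)) ⟩
      + (a₁ ℕ.* a ℕ.+ D ℕ.* (b₁ ℕ.* b))     ∎

    ε⊞-y : ∀ P {a b} → x P ≡ + a → y P ≡ + b → + 2 * y (ε ⊞ P) ≡ + (a₁ ℕ.* b ℕ.+ b₁ ℕ.* a)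
    ε⊞-y P {a} {b} x≡ y≡ = begin
      + 2 * y (ε ⊞ P)                       ≡⟨ proj₂ (⊞-isSum ε P) ⟩
      + a₁ * y P + + b₁ * x P               ≡⟨ cong₂ (λ u v → + a₁ * v + + b₁ * u) x≡ y≡ ⟩
      + a₁ * + b + + b₁ * + a               ≡⟨ cong₂ _+_ (+*+ a₁ b) (+*+ b₁ a) ⟩
      + (a₁ ℕ.* b ℕ.+ b₁ ℕ.* a)             ∎

    ⊟ε⊞-x : ∀ P {a b} → x P ≡ + a → y P ≡ + b → + 2 * x (⊟ ε ⊞ P) ≡ (a₁ ℕ.* a) ⊖ (D ℕ.* (b₁ ℕ.* b))
    ⊟ε⊞-x P {a} {b} x≡ y≡ = begin
      + 2 * x (⊟ ε ⊞ P)                     ≡⟨ proj₁ (⊞-isSum (⊟ ε) P) ⟩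
      + a₁ * x P + + D * (- + b₁ * y P)     ≡⟨ cong₂ (λ u v → + a₁ * u + + D * (- + b₁ * v)) x≡ y≡ ⟩
      + a₁ * + a + + D * (- + b₁ * + b)     ≡⟨ cong (λ k → + a₁ * + a + + D * k) (ℤP.neg-distribˡ-* (+ b₁) (+ b)) ⟨
      + a₁ * + a + + D * - (+ b₁ * + b)     ≡⟨ cong (λ k → + a₁ * + a + k) (ℤP.neg-distribʳ-* (+ D) (+ b₁ * + b)) ⟨
      + a₁ * + a - + D * (+ b₁ * + b)       ≡⟨ cong₂ (λ u v → u - + D * v) (+*+ a₁ a) (+*+ b₁ b) ⟩
      + (a₁ ℕ.* a) - + D * + (b₁ ℕ.* b)     ≡⟨ cong (λ k → + (a₁ ℕ.* a) - k) (+*+ D (b₁ ℕ.* b)) ⟩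
      + (a₁ ℕ.* a) - + (D ℕ.* (b₁ ℕ.* b))   ≡⟨ ℤP.[+m]-[+n]≡m⊖n (a₁ ℕ.* a) (D ℕ.* (b₁ ℕ.* b)) ⟩
      (a₁ ℕ.* a) ⊖ (D ℕ.* (b₁ ℕ.* b))       ∎

    ⊟ε⊞-y : ∀ P {a b} → x P ≡ + a → y P ≡ + b → + 2 * y (⊟ ε ⊞ P) ≡ (a₁ ℕ.* b) ⊖ (b₁ ℕ.* a)
    ⊟ε⊞-y P {a} {b} x≡ y≡ = begin
      + 2 * y (⊟ ε ⊞ P)                     ≡⟨ proj₂ (⊞-isSum (⊟ ε) P) ⟩
      + a₁ * y P + - + b₁ * x P             ≡⟨ cong₂ (λ u v → + a₁ * v + - + b₁ * u) x≡ y≡ ⟩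
      + a₁ * + b + - + b₁ * + a             ≡⟨ cong (λ k → + a₁ * + b + k) (ℤP.neg-distribˡ-* (+ b₁) (+ a)) ⟨
      + a₁ * + b - + b₁ * + a               ≡⟨ cong₂ _-_ (+*+ a₁ b) (+*+ b₁ a) ⟩
      + (a₁ ℕ.* b) - + (b₁ ℕ.* a)           ≡⟨ ℤP.[+m]-[+n]≡m⊖n (a₁ ℕ.* b) (b₁ ℕ.* a) ⟩
      (a₁ ℕ.* b) ⊖ (b₁ ℕ.* a)               ∎

    ⊟ε⊞-descends : ∀ P {a b} → x P ≡ +[1+ a ] → y P ≡ +[1+ b ] →
                   ∃₂ λ a′ b′ → x (⊟ ε ⊞ P) ≡ +[1+ a′ ] × y (⊟ ε ⊞ P) ≡ + b′ × b′ ℕ.< suc b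
    ⊟ε⊞-descends P {a} {b} x≡ y≡ = proj₁ x′>0 , proj₁ y′≥0 , proj₂ x′>0 , proj₁ (proj₂ y′≥0) , y′<b
      where
        P-on : suc a ℕ.* suc a ≡ 4 ℕ.+ D ℕ.* (suc b ℕ.* suc b)
        P-on = on-curve-coords P {suc a} {suc b} x≡ y≡
        open CurveBounds {D} {a₁} {b₁} {suc a} {suc b} ε-on P-on
        x-bound = Db₁b<a₁a
        x′>0 : ∃ λ a′ → x (⊟ ε ⊞ P) ≡ +[1+ a′ ]
        x′>0 = halve-pos (trans (⊟ε⊞-x P x≡ y≡) (ℤP.⊖-≥ (ℕP.<⇒≤ x-bound))) (ℕP.m<n⇒0<n∸m x-bound)
        y′≥0 : ∃ λ b′ → y (⊟ ε ⊞ P) ≡ + b′ × 2 ℕ.* b′ ≡ a₁ ℕ.* suc b ℕ.∸ b₁ ℕ.* suc a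
        y′≥0 = halve (trans (⊟ε⊞-y P x≡ y≡) (ℤP.⊖-≥ (b₁a≤a₁b (b₁-least P y≡))))
        y′<b : proj₁ y′≥0 ℕ.< suc b
        y′<b = ℕP.*-cancelˡ-< 2 (proj₁ y′≥0) (suc b) (subst (ℕ._< 2 ℕ.* suc b) (sym (proj₂ (proj₂ y′≥0)))
                 (ℕP.m<n+o⇒m∸n<o (a₁ ℕ.* suc b) (b₁ ℕ.* suc a) (a₁b<b₁a+2b 0<b₁)))

    descent : ∀ b (P : Pt (+ D)) {a} → x P ≡ +[1+ a ] → y P ≡ + b → ∃ λ n → n ×ℕ ε ≡ P
    descent = <-rec Goal step
      where
        Goal : ℕ → Set
        Goal b = ∀ (P : Pt (+ D)) {a} → x P ≡ +[1+ a ] → y P ≡ + b → ∃ λ n → n ×ℕ ε ≡ P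
        step : ∀ b → (∀ {b′} → b′ ℕ.< b → Goal b′) → Goal b
        step zero    _    P x≡ y≡ = 0 , sym (x>0∧y≡0⇒O P x≡ y≡)
        step (suc b) down P x≡ y≡ =
          let (_ , _ , x′≡ , y′≡ , b′<b) = ⊟ε⊞-descends P x≡ y≡
              (n , n×ε≡P′) = down b′<b (⊟ ε ⊞ P) x′≡ y′≡
          in suc n , (begin
            ε ⊞ n ×ℕ ε        ≡⟨ cong (ε ⊞_) n×ε≡P′ ⟩
            ε ⊞ (⊟ ε ⊞ P)     ≡⟨ ⊞-assoc ε (⊟ ε) P ⟨
            ε ⊞ ⊟ ε ⊞ P       ≡⟨ cong (_⊞ P) (⊞-inverseʳ ε) ⟩
            O ⊞ P             ≡⟨ ⊞-identityˡ P ⟩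
            P                 ∎)

    ε⊞-positive : ∀ Q {a b} → x Q ≡ +[1+ a ] → y Q ≡ + b →
                  (∃ λ a′ → x (ε ⊞ Q) ≡ +[1+ a′ ]) × (∃ λ b′ → y (ε ⊞ Q) ≡ +[1+ b′ ])
    ε⊞-positive Q {a} {b} x≡ y≡ =
      halve-pos (ε⊞-x Q x≡ y≡) (ℕP.<-≤-trans (ℕP.*-mono-< 0<a₁ (s≤s z≤n)) (ℕP.m≤m+n _ _)) ,
      halve-pos (ε⊞-y Q x≡ y≡) (ℕP.<-≤-trans (ℕP.*-mono-< 0<b₁ (s≤s z≤n)) (ℕP.m≤n+m _ _))
      where
        0<a₁ : 0 ℕ.< a₁
        0<a₁ = ℕP.n≢0⇒n>0 λ { refl → ℕP.0≢1+n ε-on }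

    ×ℕε-quadrant : ∀ n → (∃ λ a → x (n ×ℕ ε) ≡ +[1+ a ]) × (∃ λ b → y (n ×ℕ ε) ≡ + b)
    ×ℕε-quadrant zero    = (1 , refl) , (0 , refl)
    ×ℕε-quadrant (suc n) =
      let ((a , x≡) , (b , y≡)) = ×ℕε-quadrant n
          ((a′ , x′≡) , (b′ , y′≡)) = ε⊞-positive (n ×ℕ ε) x≡ y≡
      in (a′ , x′≡) , (suc b′ , y′≡)

    suc×ℕε-y>0 : ∀ n → ∃ λ b → y (suc n ×ℕ ε) ≡ +[1+ b ]
    suc×ℕε-y>0 n = let ((_ , x≡) , (_ , y≡)) = ×ℕε-quadrant n in proj₂ (ε⊞-positive (n ×ℕ ε) x≡ y≡)

    ·ε-x>0 : ∀ i → ∃ λ a → x (i · ε) ≡ +[1+ a ]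
    ·ε-x>0 (+ n)    = proj₁ (×ℕε-quadrant n)
    ·ε-x>0 -[1+ n ] = proj₁ (×ℕε-quadrant (suc n))

    ·ε≡O⇒0 : ∀ i → i · ε ≡ O → i ≡ + 0
    ·ε≡O⇒0 (+ zero)  _   = refl
    ·ε≡O⇒0 +[1+ n ]  i·ε≡O = ⊥-elim (+[1+]≢0 (trans (sym (proj₂ (suc×ℕε-y>0 n))) (cong y i·ε≡O)))
      where +[1+]≢0 : ∀ {m} → +[1+ m ] ≢ + 0
            +[1+]≢0 ()
    ·ε≡O⇒0 -[1+ n ]  i·ε≡O = ⊥-elim (-[1+]≢0 (trans (sym (cong -_ (proj₂ (suc×ℕε-y>0 n)))) (cong y i·ε≡O)))
      where -[1+]≢0 : ∀ {m} → -[1+ m ] ≢ + 0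
            -[1+]≢0 ()

    ·ε-injective : ∀ i j → i · ε ≡ j · ε → i ≡ j
    ·ε-injective i j i·ε≡j·ε = ℤP.i-j≡0⇒i≡j i j (·ε≡O⇒0 (i - j) (begin
      (i - j) · ε             ≡⟨ ·-homo-+ i (- j) ε ⟩
      i · ε ⊞ (- j) · ε       ≡⟨ cong (_⊞ (- j) · ε) i·ε≡j·ε ⟩
      j · ε ⊞ (- j) · ε       ≡⟨ ·-homo-+ j (- j) ε ⟨
      (j - j) · ε             ≡⟨ cong (_· ε) (ℤP.+-inverseʳ j) ⟩
      O                       ∎))

    ·ε-onto-x>0 : ∀ P {a} → x P ≡ +[1+ a ] → ∃ λ i → i · ε ≡ P
    ·ε-onto-x>0 P@(pt _ (+ b) _)    x≡ = let (n , n×ε≡P) = descent b P x≡ refl in + n , n×ε≡P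
    ·ε-onto-x>0 P@(pt _ -[1+ b ] _) x≡ = let (n , n×ε≡⊟P) = descent (suc b) (⊟ P) x≡ refl in - + n , (begin
      (- + n) · ε     ≡⟨ -ℕ·≈⁻¹ n ε ⟩
      ⊟ (n ×ℕ ε)      ≡⟨ cong ⊟_ n×ε≡⊟P ⟩
      ⊟ ⊟ P           ≡⟨ Pt-≡ refl (ℤP.neg-involutive (y P)) ⟩
      P               ∎)

    point : Bool × ℤ → Pt (+ D)
    point (b , i) = plusT b (i · ε)

    point-surjective : ∀ P → ∃ λ p → point p ≡ P
    point-surjective P@(pt (+ zero) _ _) = ⊥-elim (x≢0 P refl)
    point-surjective P@(pt +[1+ a ] _ _) = let (i , i·ε≡P) = ·ε-onto-x>0 P refl in (false , i) , i·ε≡P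
    point-surjective P@(pt -[1+ a ] _ _) = let (i , i·ε≡T⊞P) = ·ε-onto-x>0 (T ⊞ P) (x-T⊞ P) in (true , i) , (begin
      T ⊞ i · ε         ≡⟨ cong (T ⊞_) i·ε≡T⊞P ⟩
      T ⊞ (T ⊞ P)       ≡⟨ T⊞T⊞ P ⟩
      P                 ∎)

    x-signs-differ : ∀ i j → i · ε ≢ T ⊞ j · ε
    x-signs-differ i j eq = +≢- (begin
      +[1+ proj₁ (·ε-x>0 i) ]    ≡⟨ proj₂ (·ε-x>0 i) ⟨
      x (i · ε)                  ≡⟨ cong x eq ⟩
      x (T ⊞ j · ε)              ≡⟨ x-T⊞ (j · ε) ⟩
      - x (j · ε)                ≡⟨ cong -_ (proj₂ (·ε-x>0 j)) ⟩
      -[1+ proj₁ (·ε-x>0 j) ]    ∎)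
      where
        +≢- : ∀ {m n} → +[1+ m ] ≢ -[1+ n ]
        +≢- ()

    point-injective : ∀ p q → point p ≡ point q → p ≡ q
    point-injective (false , i) (false , j) eq = cong (false ,_) (·ε-injective i j eq)
    point-injective (true  , i) (true  , j) eq = cong (true ,_) (·ε-injective i j (begin
      i · ε              ≡⟨ T⊞T⊞ (i · ε) ⟨
      T ⊞ (T ⊞ i · ε)    ≡⟨ cong (T ⊞_) eq ⟩
      T ⊞ (T ⊞ j · ε)    ≡⟨ T⊞T⊞ (j · ε) ⟩
      j · ε              ∎))
    point-injective (false , i) (true  , j) eq = ⊥-elim (x-signs-differ i j eq)
    point-injective (true  , i) (false , j) eq = ⊥-elim (x-signs-differ j i (sym eq))

    point-homo : ∀ p q → point (p ⊕ q) ≡ point p ⊞ point q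
    point-homo (a , i) (b , j) = begin
      plusT (a xor b) ((i + j) · ε)           ≡⟨ cong (plusT (a xor b)) (·-homo-+ i j ε) ⟩
      plusT (a xor b) (i · ε ⊞ j · ε)         ≡⟨ plusT-⊞ a b (i · ε) (j · ε) ⟨
      plusT a (i · ε) ⊞ plusT b (j · ε)       ∎

    iso : IsoZ2Z (+ D)
    iso = mk↔ₛ′ coords point coords∘point point∘coords , coords-homo
      where
        coords : Pt (+ D) → Bool × ℤ
        coords P = proj₁ (point-surjective P)
        point∘coords : ∀ P → point (coords P) ≡ P
        point∘coords P = proj₂ (point-surjective P)
        coords∘point : ∀ p → coords (point p) ≡ p
        coords∘point p = point-injective _ p (point∘coords (point p))
        coords-homo : ∀ P Q R → IsSum (+ D) P Q R → coords R ≡ coords P ⊕ coords Q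
        coords-homo P Q R R≡P⊞Q = begin
          coords R                                          ≡⟨ cong coords (IsSum⇒≡⊞ R≡P⊞Q) ⟩
          coords (P ⊞ Q)
            ≡⟨ cong₂ (λ U V → coords (U ⊞ V)) (point∘coords P) (point∘coords Q) ⟨
          coords (point (coords P) ⊞ point (coords Q))      ≡⟨ cong coords (point-homo (coords P) (coords Q)) ⟨
          coords (point (coords P ⊕ coords Q))              ≡⟨ coords∘point (coords P ⊕ coords Q) ⟩
          coords P ⊕ coords Q                               ∎

    a₁≢2 : a₁ ≢ 2
    a₁≢2 refl = ℕP.<-irrefl (ℕP.+-cancelˡ-≡ 4 0 (D ℕ.* (b₁ ℕ.* b₁)) ε-on)
                            (ℕP.*-mono-< (ℕ.>-nonZero⁻¹ D) (ℕP.*-mono-< 0<b₁ 0<b₁))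

    -- A square root s of a₁ + 2 would halve ε into (s, b₁ / s), whose y is positive and below b₁.
    a₁+2-not-square : ¬ IsSquare (a₁ ℕ.+ 2)
    a₁+2-not-square (s , ss≡a₁+2) with halving a₁ b₁ s ε-on (sym ss≡a₁+2)
    ... | zero  , b₁≡s0 , _ = ℕP.<-irrefl (sym (trans b₁≡s0 (ℕP.*-zeroʳ s))) 0<b₁
    ... | suc b , b₁≡sb , ss≡ = ℕP.<-irrefl refl (ℕP.<-≤-trans b<b₁ (b₁-least (ptℕ s (suc b) ss≡) refl))
      where
        1<s : 1 ℕ.< s
        1<s = m*m<n*n⇒m<n (subst (1 ℕ.<_) (sym ss≡a₁+2) (ℕP.<-≤-trans (s≤s (s≤s z≤n)) (ℕP.m≤n+m 2 a₁)))
        b<b₁ : suc b ℕ.< b₁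
        b<b₁ = subst (suc b ℕ.<_) (trans (ℕP.*-comm (suc b) s) (sym b₁≡sb)) (ℕP.m<m*n (suc b) s 1<s)

    E : ℤ
    E = + a₁ + + 2

    E≢0 : E ≢ + 0
    E≢0 E≡0 = ℕP.0≢1+n (sym (trans (ℕP.+-comm 2 a₁) (ℤP.+-injective E≡0)))

    yε≢0 : y ε ≢ + 0
    yε≢0 b₁≡0 = ℕP.<-irrefl (sym (ℤP.+-injective b₁≡0)) 0<b₁

    E≁4 : ¬ SqEqℤ E (+ 4)
    E≁4 E~4 = a₁+2-not-square (SqEqℤ-4⇒IsSquare E~4)

    -D≁2-a₁ : ¬ SqEqℤ (- + D) (- + a₁ + + 2)
    -D≁2-a₁ -D~2-a₁ = E≁4 (SqEqℤ-sym (SqEqℤ-cancelˡ -D≢0 (SqEqℤ-trans (SqEqℤ-*4 (- + D))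
                        (SqEqℤ-trans -D~2-a₁ (2-x-class ε yε≢0 E≢0)))))
      where
        -D≢0 : - + D ≢ + 0
        -D≢0 -D≡0 = ℕ.≢-nonZero⁻¹ D (ℤP.+-injective (ℤP.neg-injective -D≡0))

    αrep : Fin 4 → ℤ
    αrep 0F = + 4
    αrep 1F = - + D
    αrep 2F = E
    αrep 3F = - + a₁ + + 2

    rep : Fin 4 → Pt (+ D)
    rep 0F = O
    rep 1F = T
    rep 2F = ε
    rep 3F = T ⊞ ε

    αℤ-rep : ∀ i → αℤ (rep i) ≡ αrep i
    αℤ-rep 0F = refl
    αℤ-rep 1F = refl
    αℤ-rep 2F = refl
    αℤ-rep 3F = trans (αℤ-x≢-2 x≢-2) (cong (_+ + 2) (x-T⊞ ε))
      where
        x≢-2 : x (T ⊞ ε) ≢ - + 2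
        x≢-2 x≡-2 = a₁≢2 (ℤP.+-injective (ℤP.neg-injective (trans (sym (x-T⊞ ε)) x≡-2)))

    private
      Pos Neg : ℤ → Set
      Pos a = ∃ λ m → a ≡ +[1+ m ]
      Neg a = ∃ λ m → a ≡ -[1+ m ]

      pos≁neg : ∀ {a b} → Pos a → Neg b → ¬ SqEqℤ a b
      pos≁neg (_ , refl) (_ , refl) = SqEqℤ-pos-neg

      αrep₀>0 : Pos (αrep 0F)
      αrep₀>0 = 3 , refl

      αrep₁<0 : Neg (αrep 1F)
      αrep₁<0 = ℕ.pred D , cong (λ n → - + n) (sym (ℕP.suc-pred D))

      αrep₂>0 : Pos (αrep 2F)
      αrep₂>0 = a₁ ℕ.+ 1 , cong +_ (ℕP.+-suc a₁ 1)

      αrep₃<0 : Neg (αrep 3F)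
      αrep₃<0 with ≥2-on-curve {a₁} ε-on
      ... | zero  , refl = ⊥-elim (a₁≢2 refl)
      ... | suc c , refl = c , refl

    αrep-injective : ∀ {i j} → SqEqℤ (αrep i) (αrep j) → i ≡ j
    αrep-injective {0F} {0F} _ = refl
    αrep-injective {1F} {1F} _ = refl
    αrep-injective {2F} {2F} _ = refl
    αrep-injective {3F} {3F} _ = refl
    αrep-injective {0F} {1F} r = ⊥-elim (pos≁neg αrep₀>0 αrep₁<0 r)
    αrep-injective {0F} {2F} r = ⊥-elim (E≁4 (SqEqℤ-sym r))
    αrep-injective {0F} {3F} r = ⊥-elim (pos≁neg αrep₀>0 αrep₃<0 r)
    αrep-injective {1F} {0F} r = ⊥-elim (pos≁neg αrep₀>0 αrep₁<0 (SqEqℤ-sym r))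
    αrep-injective {1F} {2F} r = ⊥-elim (pos≁neg αrep₂>0 αrep₁<0 (SqEqℤ-sym r))
    αrep-injective {1F} {3F} r = ⊥-elim (-D≁2-a₁ r)
    αrep-injective {2F} {0F} r = ⊥-elim (E≁4 r)
    αrep-injective {2F} {1F} r = ⊥-elim (pos≁neg αrep₂>0 αrep₁<0 r)
    αrep-injective {2F} {3F} r = ⊥-elim (pos≁neg αrep₂>0 αrep₃<0 r)
    αrep-injective {3F} {0F} r = ⊥-elim (pos≁neg αrep₀>0 αrep₃<0 (SqEqℤ-sym r))
    αrep-injective {3F} {1F} r = ⊥-elim (-D≁2-a₁ (SqEqℤ-sym r))
    αrep-injective {3F} {2F} r = ⊥-elim (pos≁neg αrep₂>0 αrep₃<0 (SqEqℤ-sym r))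

    private
      x>0⇒x+2≢0 : ∀ {z a} → z ≡ +[1+ a ] → z + + 2 ≢ + 0
      x>0⇒x+2≢0 refl ()

      sum>0⇒≢0 : ∀ {p q r a b c} → p ≡ + a → q ≡ +[1+ b ] → r ≡ +[1+ c ] → + 2 + p + q + r ≢ + 0
      sum>0⇒≢0 refl refl refl ()

    ε⊞-class : ∀ n → SqEqℤ (x (suc n ×ℕ ε) + + 2) (E * (x (n ×ℕ ε) + + 2))
    ε⊞-class n = x+2-class-⊞ {ε} {n ×ℕ ε} {suc n ×ℕ ε} (⊞-isSum ε (n ×ℕ ε))
      E≢0 (x>0⇒x+2≢0 (proj₂ (·ε-x>0 (+ n)))) (sum>0⇒≢0 refl (proj₂ (·ε-x>0 (+ n))) (proj₂ (·ε-x>0 (+ suc n))))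

    ×ℕε-class : ∀ n → SqEqℤ (x (n ×ℕ ε) + + 2) (+ 4) ⊎ SqEqℤ (x (n ×ℕ ε) + + 2) E
    ×ℕε-class zero    = inj₁ SqEqℤ-refl
    ×ℕε-class (suc n) =
      [ (λ ~4 → inj₂ (SqEqℤ-trans (ε⊞-class n) (SqEqℤ-trans (SqEqℤ-*ˡ E ~4) (SqEqℤ-*4 E))))
      , (λ ~E → inj₁ (SqEqℤ-trans (ε⊞-class n) (SqEqℤ-trans (SqEqℤ-*ˡ E ~E) (SqEqℤ-square E≢0))))
      ]′ (×ℕε-class n)

    ·ε-class : ∀ i → SqEqℤ (x (i · ε) + + 2) (+ 4) ⊎ SqEqℤ (x (i · ε) + + 2) E
    ·ε-class (+ n)    = ×ℕε-class n
    ·ε-class -[1+ n ] = ×ℕε-class (suc n)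

    Classified : Pt (+ D) → Set
    Classified P = ∃ λ i → SqEqℤ (αℤ P) (αrep i)

    ·ε-classified : ∀ i → Classified (i · ε)
    ·ε-classified i = [ (λ ~4 → 0F , SqEqℤ-respˡ α≡ ~4) , (λ ~E → 2F , SqEqℤ-respˡ α≡ ~E) ]′ (·ε-class i)
      where
        α≡ = αℤ-x>0 (proj₂ (·ε-x>0 i))

    T⊞-classified : ∀ Q {a} → x Q ≡ +[1+ a ] → Dec (x Q ≡ + 2) →
                    SqEqℤ (x Q + + 2) (+ 4) ⊎ SqEqℤ (x Q + + 2) E → Classified (T ⊞ Q)
    T⊞-classified Q x≡ (yes x≡2) _ = 1F , SqEqℤ-respˡ (αℤ-x≡-2 (trans (x-T⊞ Q) (cong -_ x≡2))) SqEqℤ-refl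
    T⊞-classified Q x≡ (no  x≢2) x+2-class =
      [ (λ ~4 → 1F , SqEqℤ-trans α~-D[x+2] (SqEqℤ-trans (SqEqℤ-*ˡ (- + D) ~4) (SqEqℤ-*4 (- + D))))
      , (λ ~E → 3F , SqEqℤ-trans α~-D[x+2] (SqEqℤ-trans (SqEqℤ-*ˡ (- + D) ~E) (SqEqℤ-sym (2-x-class ε yε≢0 E≢0))))
      ]′ x+2-class
      where
        yQ≢0 : y Q ≢ + 0
        yQ≢0 y≡0 = x≢2 (cong x (x>0∧y≡0⇒O Q x≡ y≡0))
        α~-D[x+2] : SqEqℤ (αℤ (T ⊞ Q)) (- + D * (x Q + + 2))
        α~-D[x+2] = SqEqℤ-respˡ
          (trans (αℤ-x≢-2 (λ x≡-2 → x≢2 (ℤP.neg-injective (trans (sym (x-T⊞ Q)) x≡-2)))) (cong (_+ + 2) (x-T⊞ Q)))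
          (2-x-class Q yQ≢0 (x>0⇒x+2≢0 x≡))

    point-classified : ∀ p → Classified (point p)
    point-classified (false , i) = ·ε-classified i
    point-classified (true  , i) = T⊞-classified (i · ε) (proj₂ (·ε-x>0 i)) (x (i · ε) ℤ.≟ + 2) (·ε-class i)

    classified : ∀ P → Classified P
    classified P = subst Classified (proj₂ (point-surjective P)) (point-classified (proj₁ (point-surjective P)))

    α-rep : ∀ i → α (+ D) (rep i) ≡ αrep i ℚ./ 1
    α-rep i = trans (α≡αℤ/1 (rep i)) (cong (λ a → a ℚ./ 1) (αℤ-rep i))

    image : ImageCard4 (+ D)
    image = rep , distinct , cover
      where
        distinct : ∀ i j → i ≢ j → ¬ SqEq (α (+ D) (rep i)) (α (+ D) (rep j))
        distinct i j i≢j sq = i≢j (αrep-injective (SqEq⇒SqEqℤ (subst₂ SqEq (α-rep i) (α-rep j) sq)))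
        cover : ∀ P → ∃ λ i → SqEq (α (+ D) P) (α (+ D) (rep i))
        cover P = let (i , α~αrep) = classified P in
                  i , subst₂ SqEq (sym (α≡αℤ/1 P)) (sym (α-rep i)) (SqEqℤ⇒SqEq α~αrep)

  nontrivial⇒iso×image : (∃ λ P → y P ≢ + 0) → IsoZ2Z (+ D) × ImageCard4 (+ D)
  nontrivial⇒iso×image (P , y≢0) = iso , image
    where
      Solution : ℕ → Set
      Solution b = 0 ℕ.< b × IsSquare (4 ℕ.+ D ℕ.* (b ℕ.* b))
      solution : (Q : Pt (+ D)) → ∣ y Q ∣ ≢ 0 → Solution ∣ y Q ∣
      solution Q ∣y∣≢0 = ℕP.n≢0⇒n>0 ∣y∣≢0 , ∣ x Q ∣ , on-curve-ℕ Q
      least : ∃ λ b₁ → Solution b₁ × (∀ {b} → b ℕ.< b₁ → ¬ Solution b)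
      least = least-witness (λ b → (0 ℕ.<? b) ×-dec isSquare? (4 ℕ.+ D ℕ.* (b ℕ.* b)))
                (solution P (y≢0 ∘ ℤP.∣i∣≡0⇒i≡0))
      b₁ = proj₁ least
      0<b₁ = proj₁ (proj₁ (proj₂ least))
      a₁ = proj₁ (proj₂ (proj₁ (proj₂ least)))
      ε-on = proj₂ (proj₂ (proj₁ (proj₂ least)))
      b₁-least : ∀ (Q : Pt (+ D)) {b} → y Q ≡ +[1+ b ] → b₁ ℕ.≤ suc b
      b₁-least Q y≡ = ℕP.≮⇒≥ λ 1+b<b₁ → proj₂ (proj₂ least) 1+b<b₁
        (subst Solution (cong ∣_∣ y≡) (solution Q λ ∣y∣≡0 → ℕP.0≢1+n (trans (sym ∣y∣≡0) (cong ∣_∣ y≡))))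
      open Generator {a₁} {b₁} ε-on 0<b₁ b₁-least using (iso; image)

  iso⇒nontrivial : IsoZ2Z (+ D) → ∃ λ P → y P ≢ + 0
  iso⇒nontrivial (f , homo) = P , y≢0
    where
      open Inverse f
      P = from (false , + 1)
      i≡i+i⇒i≡0 : ∀ {i} → i ≡ i + i → i ≡ + 0
      i≡i+i⇒i≡0 {i} i≡i+i = begin
        i          ≡⟨ k+j-j≡k i i ⟨
        i + i - i  ≡⟨ cong (_- i) i≡i+i ⟨
        i - i      ≡⟨ ℤP.+-inverseʳ i ⟩
        + 0        ∎
      to-O : proj₂ (to O) ≡ + 0
      to-O = i≡i+i⇒i≡0 (cong proj₂ (homo O O O (subst (IsSum (+ D) O O) (⊞-identityˡ O) (⊞-isSum O O))))
      y≢0 : y P ≢ + 0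
      y≢0 y≡0 with y≡0⇒O⊎T P y≡0
      ... | inj₁ P≡O = +1≢0 (begin
        + 1                  ≡⟨ cong proj₂ (strictlyInverseˡ (false , + 1)) ⟨
        proj₂ (to P)         ≡⟨ cong (λ Q → proj₂ (to Q)) P≡O ⟩
        proj₂ (to O)         ≡⟨ to-O ⟩
        + 0                  ∎)
        where +1≢0 : + 1 ≢ + 0
              +1≢0 ()
      ... | inj₂ P≡T = +2≢0 (trans (sym (cong proj₂ to-O≡to-T⊕to-T)) to-O)
        where
          +2≢0 : + 2 ≢ + 0
          +2≢0 ()
          to-O≡to-T⊕to-T : to O ≡ (false , + 1) ⊕ (false , + 1)
          to-O≡to-T⊕to-T = trans (homo T T O (subst (IsSum (+ D) T T) T⊞T≡O (⊞-isSum T T)))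
            (cong (λ p → p ⊕ p) (trans (cong to (sym P≡T)) (strictlyInverseˡ (false , + 1))))

  image⇒nontrivial : ImageCard4 (+ D) → ∃ λ P → y P ≢ + 0
  image⇒nontrivial (rep , distinct , _) = distinct⇒y≢0 (rep 0F) (rep 1F) (rep 2F)
    (rep-injective 0F 1F (λ ())) (rep-injective 0F 2F (λ ())) (rep-injective 1F 2F (λ ()))
    where
      rep-injective : ∀ i j → i ≢ j → rep i ≢ rep j
      rep-injective i j i≢j rep-i≡rep-j =
        distinct i j i≢j (ℚ.1ℚ , (λ ()) , trans (cong (α (+ D)) rep-i≡rep-j) (sym (ℚP.*-identityʳ _)))

  iso⇔image : IsoZ2Z (+ D) ⇔ ImageCard4 (+ D)
  iso⇔image = mk⇔ (λ iso → proj₂ (nontrivial⇒iso×image (iso⇒nontrivial iso)))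
                  (λ image → proj₁ (nontrivial⇒iso×image (image⇒nontrivial image)))

Disc-cases : ∀ d → Disc d ≡ d ⊎ Disc d ≡ + 4 * d
Disc-cases d with d ℤ.%ℕ 4 ℕ.≟ 1
... | yes _ = inj₁ refl
... | no  _ = inj₂ refl

0<Disc⇒0<d : ∀ d → + 0 < Disc d → + 0 < d
0<Disc⇒0<d d 0<Δ with Disc-cases d
... | inj₁ Δ≡d  = subst (+ 0 <_) Δ≡d 0<Δ
... | inj₂ Δ≡4d = ℤP.*-cancelˡ-<-nonNeg (+ 4) (subst (+ 0 <_) Δ≡4d 0<Δ)

Disc-positive : ∀ d → SquareFree d → + 0 < d → ∃ λ D → Disc d ≡ + D × ℕ.NonZero D × Halving D
Disc-positive +[1+ k ] sf _ with Disc-cases +[1+ k ]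
... | inj₁ Δ≡d  = suc k , Δ≡d , _ , halving-squarefree sf
... | inj₂ Δ≡4d = 4 ℕ.* suc k , trans Δ≡4d (sym (ℤP.pos-* 4 (suc k))) , _ , halving-4* sf
Disc-positive (+ zero) _ (ℤ.+<+ ())

theorem3p10 : (d : ℤ) → SquareFree d → d ≢ + 1 → + 0 < Disc d →
    IsoZ2Z (Disc d) ⇔ ImageCard4 (Disc d)
theorem3p10 d sf _ 0<Δ =
  let (D , Δ≡D , D≢0 , halving) = Disc-positive d sf (0<Disc⇒0<d d 0<Δ) in
  subst (λ Δ → IsoZ2Z Δ ⇔ ImageCard4 Δ) (sym Δ≡D) (PositiveDiscriminant.iso⇔image D {{D≢0}} halving)
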